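{- For $n,k,z\in\mathbb{N}$, the Jacobi-Stirling number of the first kind $Jc_n^{(k)}(z)$ equals the number of pairs $(\sigma,\tau)\in S_n\times S_{n+z}$ such that $\sigma$ and $\tau$ have the same ordered cycle structure up to $k$, $\sigma$ has exactly $k$ cycles and $\tau$ has exactly $k+z$ cycles.
   Context: $Jc_n^{(k)}(z)=e_{n-k}\big(1(1+z),2(2+z),\dots,(n-1)(n-1+z)\big)$, where $e_m$ is the elementary symmetric polynomial of degree $m$ ($e_0=1$; $e_m=0$ if $m<0$ or $m$ exceeds the number of variables). For a permutation, write each cycle with its minimum first and order cycles by increasing minima; the ordered cycle structure is the sequence of cycle lengths. Permutations have the same ordered cycle structure up to $m$ if the first $m$ entries of their cycle-length sequences coincide and all remaining cycles have length $1$. -}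

module Defs where

open import Data.Nat using (ℕ; zero; suc; _+_; _*_; _∸_; _≤_; _≤?_)
open import Data.Nat.Properties using () renaming (_≟_ to _≟ℕ_)
open import Data.Fin using (Fin; toℕ) renaming (_≟_ to _≟F_)
open import Data.Vec using (Vec; []; _∷_; lookup; toList)
open import Data.List using (List; []; _∷_; [_]; map; concatMap; allFin; upTo; filter; length; take; drop; takeWhile; cartesianProduct)
open import Data.List.Properties using (≡-dec)
open import Data.List.Relation.Unary.All using (All; all?)
open import Data.List.Relation.Unary.Unique.Propositional using (Unique)
open import Data.List.Relation.Unary.Unique.DecPropositional using (unique?)
open import Data.Product using (_×_; _,_)
open import Relation.Nullary using (Dec; yes; no; ¬?)
open import Relation.Nullary.Decidable using (_×-dec_)
open import Relation.Binary.PropositionalEquality using (_≡_)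

esym : ℕ → List ℕ → ℕ
esym zero    _        = 1
esym (suc m) []       = 0
esym (suc m) (x ∷ xs) = x * esym m xs + esym (suc m) xs

jsVars : ℕ → ℕ → List ℕ
jsVars n z = map (λ i → suc i * (suc i + z)) (upTo (n ∸ 1))

Jc : ℕ → ℕ → ℕ → ℕ
Jc n k z with k ≤? n
... | yes _ = esym (n ∸ k) (jsVars n z)
... | no  _ = 0

-- Permutations of Fin n, represented by their image vector (σ(0),…,σ(n-1))

allVecs : (m n : ℕ) → List (Vec (Fin n) m)
allVecs zero    n = [ [] ]
allVecs (suc m) n = concatMap (λ i → map (i ∷_) (allVecs m n)) (allFin n)

IsPerm : ∀ {n} → Vec (Fin n) n → Set
IsPerm σ = Unique (toList σ)

isPerm? : ∀ {n} (σ : Vec (Fin n) n) → Dec (IsPerm σ)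
isPerm? σ = unique? _≟F_ (toList σ)

perms : (n : ℕ) → List (Vec (Fin n) n)
perms n = filter isPerm? (allVecs n n)

iter : ∀ {n} → Vec (Fin n) n → ℕ → Fin n → Fin n
iter σ zero    i = i
iter σ (suc j) i = lookup σ (iter σ j i)

IsCycleMin : ∀ {n} → Vec (Fin n) n → Fin n → Set
IsCycleMin {n} σ i = All (λ j → toℕ i ≤ toℕ (iter σ j i)) (upTo n)

isCycleMin? : ∀ {n} (σ : Vec (Fin n) n) (i : Fin n) → Dec (IsCycleMin σ i)
isCycleMin? {n} σ i = all? (λ j → toℕ i ≤? toℕ (iter σ j i)) (upTo n)

cycleLen : ∀ {n} → Vec (Fin n) n → Fin n → ℕ
cycleLen {n} σ i =
  suc (length (takeWhile (λ m → ¬? (iter σ (suc m) i ≟F i)) (upTo n)))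

-- ordered cycle structure: cycle lengths, cycles ordered by increasing minima
cycleType : ∀ {n} → Vec (Fin n) n → List ℕ
cycleType {n} σ = map (cycleLen σ) (filter (isCycleMin? σ) (allFin n))

numCycles : ∀ {n} → Vec (Fin n) n → ℕ
numCycles σ = length (cycleType σ)

SameUpTo : ℕ → List ℕ → List ℕ → Set
SameUpTo m c d = take m c ≡ take m d × All (_≡ 1) (drop m c) × All (_≡ 1) (drop m d)

sameUpTo? : ∀ m c d → Dec (SameUpTo m c d)
sameUpTo? m c d = ≡-dec _≟ℕ_ (take m c) (take m d)
  ×-dec (all? (_≟ℕ 1) (drop m c) ×-dec all? (_≟ℕ 1) (drop m d))

GoodPair : ∀ {n z} → ℕ → Vec (Fin n) n × Vec (Fin (n + z)) (n + z) → Set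
GoodPair {n} {z} k (σ , τ) =
  SameUpTo k (cycleType σ) (cycleType τ) × numCycles σ ≡ k × numCycles τ ≡ k + z

goodPair? : ∀ {n z} k (p : Vec (Fin n) n × Vec (Fin (n + z)) (n + z)) → Dec (GoodPair {n} {z} k p)
goodPair? k (σ , τ) = sameUpTo? k (cycleType σ) (cycleType τ)
  ×-dec (numCycles σ ≟ℕ k ×-dec numCycles τ ≟ℕ (k + _))

countPairs : ℕ → ℕ → ℕ → ℕ
countPairs n k z = length (filter (goodPair? {n} {z} k) (cartesianProduct (perms n) (perms (n + z))))

module Submission where

-- Both sides satisfy Jc(n+1, k+1) = Jc(n, k) + n(n+z) Jc(n, k+1) and agree for n = 0 or k = 0.
-- By the conditions on the numbers of cycles, the ordered cycle structure of τ is that of σ followed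
-- by z fixed points, so the pairs number ∑_D w(n, D) · w(n+z, D ++ 1ᶻ) over the compositions D of n
-- into k parts, where w(m, D) counts the permutations of Fin m of ordered cycle structure D.
-- Inserting the point m into a permutation of Fin m, as a fixed point or right after one of the m
-- points, shows w(m, l ∷ D) = (m-1)(m-2)⋯(m-l+1) · w(m-l, D); splitting off the first part of D
-- then gives the recurrence.

open import Data.Bool using (true; false; if_then_else_)
open import Data.Fin using (Fin; zero; suc; toℕ; fromℕ; fromℕ<; inject₁; lower₁) renaming (_≟_ to _≟ᶠ_)
open import Data.Fin.Properties using (fromℕ≢inject₁; inject₁-injective; any?; pigeonhole; toℕ-injective; toℕ-fromℕ; lower₁-injective; inject₁-lower₁; toℕ<n; toℕ-fromℕ<; toℕ-inject₁)
open import Data.Fin.Relation.Unary.Top using (View; view; ‵fromℕ; ‵inject₁; view-fromℕ; view-inject₁)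
open import Data.List using (List; []; _∷_; _++_; [_]; map; filter; length; concatMap; upTo; applyUpTo; takeWhile; allFin; cartesianProductWith; cartesianProduct; take; drop; replicate)
import Data.List as List
open import Data.List.Membership.Propositional using (_∈_)
open import Data.List.Membership.Propositional.Properties using (∈-upTo⁺; ∈-upTo⁻; ∈-allFin; ∈-filter⁺; ∈-filter⁻; ∈-map⁺; ∈-map⁻; ∈-cartesianProductWith⁺; ∈-cartesianProductWith⁻)
open import Data.List.Membership.Propositional.Properties.WithK using (unique∧set⇒bag)
open import Data.List.Properties using (≡-dec; ∷-injective; map-++; map-∘; map-cong; map-cong-local; map-upTo; map-tabulate; upTo-∷ʳ; length-upTo; length-map; length-tabulate; length-++; length-replicate; length-drop; take-all; drop-all; take++drop≡id; filter-++; filter-accept; filter-reject; ++-identityʳ)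
open import Data.List.Relation.Binary.BagAndSetEquality using (∼bag⇒↭)
open import Data.List.Relation.Binary.Permutation.Propositional using (_↭_)
open import Data.List.Relation.Binary.Permutation.Propositional.Properties using (↭-length) renaming (map⁺ to ↭-map⁺)
open import Data.List.Relation.Unary.All using (All; []; _∷_)
import Data.List.Relation.Unary.All as All
open import Data.List.Relation.Unary.All.Properties using (applyUpTo⁺₂; applyUpTo⁻; replicate⁺)
open import Data.List.Relation.Unary.Any using (here; there)
open import Data.List.Relation.Unary.Unique.Propositional using (Unique; []; _∷_)
open import Data.List.Relation.Unary.Unique.Propositional.Properties using (tabulate⁺; allFin⁺; upTo⁺; filter⁺; map⁺; cartesianProductWith⁺)
open import Data.Maybe using (Maybe; nothing; just)
open import Data.Maybe.Properties using (just-injective) renaming (≡-dec to ≡-decᴹ)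
open import Data.Nat using (ℕ; zero; suc; _≟_; _≡ᵇ_; _+_; _*_; _∸_; _≤_; _<_; z≤n; s≤s; s≤s⁻¹; _≤?_)
open import Data.Nat.Combinatorics.Base using (_P′_)
open import Data.Nat.Combinatorics.Specification using (nP′k≡n[n∸1P′k∸1])
open import Data.Nat.DivMod using (_%_; _/_; m≡m%n+[m/n]*n; m%n<n)
open import Data.Nat.ListAction using (sum)
open import Data.Nat.ListAction.Properties using (sum-++; sum-↭)
open import Data.Nat.Properties
open import Data.Nat.Tactic.RingSolver using (solve-∀)
open import Data.Product using (_×_; _,_; proj₂; map₂; ∃; uncurry)
open import Data.Sum using (_⊎_; inj₁; inj₂)
open import Data.Vec using (Vec; []; _∷_; lookup; toList; tabulate)
open import Data.Vec.Properties using (lookup∘tabulate; tabulate∘lookup; tabulate-cong) renaming (∷-injective to ∷-injectiveᵛ)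
open import Function using (id; _∘_; case_of_)
open import Function.Bundles using (mk⇔)
open import Function.Definitions using (Injective)
open import Relation.Binary.Definitions using (DecidableEquality; tri<; tri≈; tri>)
open import Relation.Binary.PropositionalEquality hiding ([_])
open import Relation.Nullary using (Dec; yes; no; does; ¬_; ¬?; contradiction)
open import Relation.Nullary.Decidable using (_×-dec_; decidable-stable)
open import Relation.Unary using (Pred; Decidable)

open import Defs
open ≡-Reasoning

-- Finite sums

private variable
  A B C : Set

∑ : (A → ℕ) → List A → ℕ
∑ f xs = sum (map f xs)

∑-++ : ∀ (f : A → ℕ) xs ys → ∑ f (xs ++ ys) ≡ ∑ f xs + ∑ f ys
∑-++ f xs ys = trans (cong sum (map-++ f xs ys)) (sum-++ (map f xs) (map f ys))

∑-map : ∀ (f : B → ℕ) (g : A → B) xs → ∑ f (map g xs) ≡ ∑ (f ∘ g) xs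
∑-map f g xs = cong sum (sym (map-∘ xs))

∑-cong : ∀ {f g : A → ℕ} → (∀ x → f x ≡ g x) → ∀ xs → ∑ f xs ≡ ∑ g xs
∑-cong f≗g xs = cong sum (map-cong f≗g xs)

∑-cong-∈ : ∀ {f g : A → ℕ} xs → (∀ {x} → x ∈ xs → f x ≡ g x) → ∑ f xs ≡ ∑ g xs
∑-cong-∈ xs f≗g = cong sum (map-cong-local (All.tabulate f≗g))

∑-+ : ∀ (f g : A → ℕ) xs → ∑ (λ x → f x + g x) xs ≡ ∑ f xs + ∑ g xs
∑-+ f g []       = refl
∑-+ f g (x ∷ xs) = begin
  (f x + g x) + ∑ (λ x → f x + g x) xs ≡⟨ cong (f x + g x +_) (∑-+ f g xs) ⟩
  (f x + g x) + (∑ f xs + ∑ g xs)      ≡⟨ +-+-comm (f x) (g x) _ _ ⟩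
  (f x + ∑ f xs) + (g x + ∑ g xs)      ∎
  where +-+-comm : ∀ a b c d → (a + b) + (c + d) ≡ (a + c) + (b + d)
        +-+-comm = solve-∀

∑-*ˡ : ∀ (k : ℕ) (f : A → ℕ) xs → ∑ (λ x → k * f x) xs ≡ k * ∑ f xs
∑-*ˡ k f []       = sym (*-zeroʳ k)
∑-*ˡ k f (x ∷ xs) = trans (cong (k * f x +_) (∑-*ˡ k f xs)) (sym (*-distribˡ-+ k (f x) _))

∑-*ʳ : ∀ (k : ℕ) (f : A → ℕ) xs → ∑ (λ x → f x * k) xs ≡ ∑ f xs * k
∑-*ʳ k f xs = trans (∑-cong (λ x → *-comm (f x) k) xs) (trans (∑-*ˡ k f xs) (*-comm k _))

∑-zero-∈ : ∀ {f : A → ℕ} xs → (∀ {x} → x ∈ xs → f x ≡ 0) → ∑ f xs ≡ 0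
∑-zero-∈ xs f≡0 = trans (∑-cong-∈ xs f≡0) (∑-const-0 xs)
  where ∑-const-0 : ∀ xs → ∑ (λ _ → 0) xs ≡ 0
        ∑-const-0 []       = refl
        ∑-const-0 (_ ∷ xs) = ∑-const-0 xs

∑-zero : ∀ {f : A → ℕ} → (∀ x → f x ≡ 0) → ∀ xs → ∑ f xs ≡ 0
∑-zero f≡0 xs = ∑-zero-∈ xs (λ {x} _ → f≡0 x)

∑≡0⇒ : ∀ {f : A → ℕ} xs → ∑ f xs ≡ 0 → ∀ {x} → x ∈ xs → f x ≡ 0
∑≡0⇒ {f = f} (y ∷ xs) ∑≡0 (here refl) = m+n≡0⇒m≡0 (f y) ∑≡0
∑≡0⇒ {f = f} (y ∷ xs) ∑≡0 (there x∈xs) = ∑≡0⇒ xs (m+n≡0⇒n≡0 (f y) ∑≡0) x∈xs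

∑-comm : ∀ (h : A → B → ℕ) xs ys → ∑ (λ x → ∑ (h x) ys) xs ≡ ∑ (λ y → ∑ (λ x → h x y) xs) ys
∑-comm h []       ys = sym (∑-zero (λ _ → refl) ys)
∑-comm h (x ∷ xs) ys =
  trans (cong (∑ (h x) ys +_) (∑-comm h xs ys)) (sym (∑-+ (h x) (λ y → ∑ (λ x → h x y) xs) ys))

∑-cartesianProductWith : ∀ (g : C → ℕ) (f : A → B → C) xs ys →
  ∑ g (cartesianProductWith f xs ys) ≡ ∑ (λ x → ∑ (λ y → g (f x y)) ys) xs
∑-cartesianProductWith g f []       ys = refl
∑-cartesianProductWith g f (x ∷ xs) ys = trans (∑-++ g (map (f x) ys) _)
  (cong₂ _+_ (∑-map g (f x) ys) (∑-cartesianProductWith g f xs ys))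

∑-concatMap : ∀ (f : B → ℕ) (g : A → List B) xs → ∑ f (concatMap g xs) ≡ ∑ (λ x → ∑ f (g x)) xs
∑-concatMap f g []       = refl
∑-concatMap f g (x ∷ xs) = trans (∑-++ f (g x) (concatMap g xs)) (cong (∑ f (g x) +_) (∑-concatMap f g xs))

∑-↭ : ∀ (f : A → ℕ) {xs ys} → xs ↭ ys → ∑ f xs ≡ ∑ f ys
∑-↭ f xs↭ys = sum-↭ (↭-map⁺ f xs↭ys)

∑-upTo-suc : ∀ (g : ℕ → ℕ) n → ∑ g (upTo (suc n)) ≡ g 0 + ∑ (g ∘ suc) (upTo n)
∑-upTo-suc g n = cong (g 0 +_) (trans (cong (∑ g) (sym (map-upTo suc n))) (∑-map g suc (upTo n)))

∑-upTo-cong : ∀ {g h : ℕ → ℕ} n → (∀ l → l < n → g l ≡ h l) → ∑ g (upTo n) ≡ ∑ h (upTo n)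
∑-upTo-cong n g≗h = ∑-cong-∈ (upTo n) (λ l∈ → g≗h _ (∈-upTo⁻ l∈))

opaque
  𝟙 : ∀ {p} {P : Set p} → Dec P → ℕ
  𝟙 P? = if does P? then 1 else 0

  𝟙-yes : ∀ {p} {P : Set p} (P? : Dec P) → P → 𝟙 P? ≡ 1
  𝟙-yes (yes _) _ = refl
  𝟙-yes (no ¬p) p = contradiction p ¬p

  𝟙-no : ∀ {p} {P : Set p} (P? : Dec P) → ¬ P → 𝟙 P? ≡ 0
  𝟙-no (yes p) ¬p = contradiction p ¬p
  𝟙-no (no _)  _  = refl

  𝟙-cong : ∀ {p q} {P : Set p} {Q : Set q} (P? : Dec P) (Q? : Dec Q) → (P → Q) → (Q → P) → 𝟙 P? ≡ 𝟙 Q?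
  𝟙-cong (yes p) (yes q) _ _ = refl
  𝟙-cong (yes p) (no ¬q) f _ = contradiction (f p) ¬q
  𝟙-cong (no ¬p) (yes q) _ g = contradiction (g q) ¬p
  𝟙-cong (no ¬p) (no ¬q) _ _ = refl

  𝟙-× : ∀ {P Q : Set} (P? : Dec P) (Q? : Dec Q) → 𝟙 (P? ×-dec Q?) ≡ 𝟙 P? * 𝟙 Q?
  𝟙-× (yes _) (yes _) = refl
  𝟙-× (yes _) (no _)  = refl
  𝟙-× (no _)  _       = refl

  length-filter≡∑𝟙 : ∀ {p} {P : Pred A p} (P? : Decidable P) xs →
                     length (filter P? xs) ≡ ∑ (λ x → 𝟙 (P? x)) xs
  length-filter≡∑𝟙 P? []       = refl
  length-filter≡∑𝟙 P? (x ∷ xs) with does (P? x)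
  ... | true  = cong suc (length-filter≡∑𝟙 P? xs)
  ... | false = length-filter≡∑𝟙 P? xs

unique-⊆⊇⇒↭ : {xs ys : List A} → Unique xs → Unique ys →
              (∀ {x} → x ∈ xs → x ∈ ys) → (∀ {x} → x ∈ ys → x ∈ xs) → xs ↭ ys
unique-⊆⊇⇒↭ !xs !ys xs⊆ys ys⊆xs = ∼bag⇒↭ (unique∧set⇒bag !xs !ys (mk⇔ xs⊆ys ys⊆xs))

∑-𝟙-≡ : ∀ {x₀ : A} (_≟_ : DecidableEquality A) (h : A → ℕ) xs → Unique xs → x₀ ∈ xs →
        ∑ (λ x → 𝟙 (x ≟ x₀) * h x) xs ≡ h x₀
∑-𝟙-≡ _≟_ h (x ∷ xs) (x∉xs ∷ !xs) (here refl) = begin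
  𝟙 (x ≟ x) * h x + ∑ (λ y → 𝟙 (y ≟ x) * h y) xs ≡⟨ cong₂ _+_ (cong (_* h x) (𝟙-yes (x ≟ x) refl)) rest≡0 ⟩
  1 * h x + 0                                     ≡⟨ trans (+-identityʳ _) (*-identityˡ _) ⟩
  h x                                             ∎
  where rest≡0 = ∑-zero-∈ xs (λ {y} y∈xs → cong (_* h y) (𝟙-no (y ≟ x) (All.lookup x∉xs y∈xs ∘ sym)))
∑-𝟙-≡ {x₀ = x₀} _≟_ h (x ∷ xs) (x∉xs ∷ !xs) (there x₀∈xs) =
  trans (cong (λ t → t * h x + _) (𝟙-no (x ≟ x₀) (All.lookup x∉xs x₀∈xs))) (∑-𝟙-≡ _≟_ h xs !xs x₀∈xs)

-- Permutations and the insertion of a new point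

private variable
  n : ℕ

≗⇒≡ : {v w : Vec A n} → (∀ i → lookup v i ≡ lookup w i) → v ≡ w
≗⇒≡ {v = v} {w} v≗w = trans (sym (tabulate∘lookup v)) (trans (tabulate-cong v≗w) (tabulate∘lookup w))

IsPerm⇒injective : ∀ (σ : Vec (Fin n) n) → IsPerm σ → Injective _≡_ _≡_ (lookup σ)
IsPerm⇒injective σ = go σ
  where
  lookup∈toList : ∀ {m} (v : Vec (Fin n) m) i → lookup v i ∈ toList v
  lookup∈toList (x ∷ v) zero    = here refl
  lookup∈toList (x ∷ v) (suc i) = there (lookup∈toList v i)
  go : ∀ {m} (v : Vec (Fin n) m) → Unique (toList v) → Injective _≡_ _≡_ (lookup v)
  go (x ∷ v) (x∉v ∷ !v) {zero}  {zero}  _  = refl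
  go (x ∷ v) (x∉v ∷ !v) {zero}  {suc j} eq = contradiction eq (All.lookup x∉v (lookup∈toList v j))
  go (x ∷ v) (x∉v ∷ !v) {suc i} {zero}  eq = contradiction (sym eq) (All.lookup x∉v (lookup∈toList v i))
  go (x ∷ v) (x∉v ∷ !v) {suc i} {suc j} eq = cong suc (go v !v eq)

injective⇒IsPerm : ∀ (σ : Vec (Fin n) n) → Injective _≡_ _≡_ (lookup σ) → IsPerm σ
injective⇒IsPerm σ inj = subst Unique (sym (toList≡tabulate σ)) (tabulate⁺ inj)
  where
  toList≡tabulate : ∀ {m} (v : Vec (Fin n) m) → toList v ≡ List.tabulate (lookup v)
  toList≡tabulate []      = refl
  toList≡tabulate (x ∷ v) = cong (x ∷_) (toList≡tabulate v)

allVecs≡cartesianProduct : ∀ m n → allVecs (suc m) n ≡ cartesianProductWith _∷_ (allFin n) (allVecs m n)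
allVecs≡cartesianProduct m n = go (allFin n)
  where
  go : ∀ xs → concatMap (λ i → map (i ∷_) (allVecs m n)) xs ≡ cartesianProductWith _∷_ xs (allVecs m n)
  go []       = refl
  go (x ∷ xs) = cong (map (x ∷_) (allVecs m n) ++_) (go xs)

allVecs-unique : ∀ m n → Unique (allVecs m n)
allVecs-unique zero    n = [] ∷ []
allVecs-unique (suc m) n rewrite allVecs≡cartesianProduct m n =
  cartesianProductWith⁺ _∷_ ∷-injectiveᵛ (allFin⁺ n) (allVecs-unique m n)

∈-allVecs : ∀ m n (v : Vec (Fin n) m) → v ∈ allVecs m n
∈-allVecs zero    n []      = here refl
∈-allVecs (suc m) n (x ∷ v) rewrite allVecs≡cartesianProduct m n =
  ∈-cartesianProductWith⁺ _∷_ (∈-allFin x) (∈-allVecs m n v)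

perms-unique : ∀ n → Unique (perms n)
perms-unique n = filter⁺ isPerm? (allVecs-unique n n)

∈-perms⁺ : {σ : Vec (Fin n) n} → IsPerm σ → σ ∈ perms n
∈-perms⁺ {n} {σ} = ∈-filter⁺ isPerm? (∈-allVecs n n σ)

∈-perms⁻ : {σ : Vec (Fin n) n} → σ ∈ perms n → IsPerm σ
∈-perms⁻ {n} σ∈ = proj₂ (∈-filter⁻ isPerm? {xs = allVecs n n} σ∈)

_≟ᴹ_ : DecidableEquality (Maybe (Fin n))
_≟ᴹ_ = ≡-decᴹ _≟ᶠ_

extendᵛ : (Fin n → Fin n) → Maybe (Fin n) → {i : Fin (suc n)} → View i → Fin (suc n)
extendᵛ {n} f nothing  ‵fromℕ        = fromℕ n
extendᵛ     f (just a) ‵fromℕ        = inject₁ (f a)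
extendᵛ     f nothing  (‵inject₁ j)  = inject₁ (f j)
extendᵛ {n} f (just a) (‵inject₁ j) with j ≟ᶠ a
... | yes _ = fromℕ n
... | no  _ = inject₁ (f j)

extend : (Fin n → Fin n) → Maybe (Fin n) → Fin (suc n) → Fin (suc n)
extend f c i = extendᵛ f c (view i)

module _ (f : Fin n → Fin n) where

  extend-top-nothing : extend f nothing (fromℕ n) ≡ fromℕ n
  extend-top-nothing rewrite view-fromℕ n = refl

  extend-top-just : ∀ a → extend f (just a) (fromℕ n) ≡ inject₁ (f a)
  extend-top-just a rewrite view-fromℕ n = refl

  extend-inject₁-hit : ∀ a → extend f (just a) (inject₁ a) ≡ fromℕ n
  extend-inject₁-hit a rewrite view-inject₁ a with a ≟ᶠ a
  ... | yes _  = refl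
  ... | no a≢a = contradiction refl a≢a

  extend-inject₁ : ∀ c j → c ≢ just j → extend f c (inject₁ j) ≡ inject₁ (f j)
  extend-inject₁ nothing  j _ rewrite view-inject₁ j = refl
  extend-inject₁ (just a) j c≢j rewrite view-inject₁ j with j ≟ᶠ a
  ... | yes refl = contradiction refl c≢j
  ... | no  _    = refl

  extend-top≢inject₁ : Injective _≡_ _≡_ f → ∀ c k → extend f c (fromℕ n) ≢ extend f c (inject₁ k)
  extend-top≢inject₁ f-inj nothing  k eq =
    fromℕ≢inject₁ (trans (sym extend-top-nothing) (trans eq (extend-inject₁ nothing k λ ())))
  extend-top≢inject₁ f-inj (just a) k eq with a ≟ᶠ k
  ... | yes refl = fromℕ≢inject₁ (trans (sym (extend-inject₁-hit k)) (trans (sym eq) (extend-top-just k)))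
  ... | no a≢k   = a≢k (f-inj (inject₁-injective
                     (trans (sym (extend-top-just a)) (trans eq (extend-inject₁ (just a) k (a≢k ∘ just-injective))))))

  extend-injective : Injective _≡_ _≡_ f → ∀ c → Injective _≡_ _≡_ (extend f c)
  extend-injective f-inj c {i} {i′} = go (view i) (view i′)
    where
    inject₁-image : ∀ j k → extend f c (inject₁ j) ≡ extend f c (inject₁ k) → j ≡ k
    inject₁-image j k eq with c ≟ᴹ just j | c ≟ᴹ just k
    ... | yes refl | yes refl = refl
    ... | yes refl | no c≢k   = contradiction (trans (sym (extend-inject₁-hit j)) (trans eq (extend-inject₁ c k c≢k))) fromℕ≢inject₁
    ... | no c≢j   | yes refl = contradiction (trans (sym (extend-inject₁-hit k)) (trans (sym eq) (extend-inject₁ c j c≢j))) fromℕ≢inject₁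
    ... | no c≢j   | no c≢k   = f-inj (inject₁-injective (trans (sym (extend-inject₁ c j c≢j)) (trans eq (extend-inject₁ c k c≢k))))
    go : ∀ {i i′} → View i → View i′ → extend f c i ≡ extend f c i′ → i ≡ i′
    go ‵fromℕ       ‵fromℕ       _  = refl
    go ‵fromℕ       (‵inject₁ k) eq = contradiction eq (extend-top≢inject₁ f-inj c k)
    go (‵inject₁ j) ‵fromℕ       eq = contradiction (sym eq) (extend-top≢inject₁ f-inj c j)
    go (‵inject₁ j) (‵inject₁ k) eq = cong inject₁ (inject₁-image j k eq)

insert : Vec (Fin n) n → Maybe (Fin n) → Vec (Fin (suc n)) (suc n)
insert σ c = tabulate (extend (lookup σ) c)

lookup-insert : ∀ (σ : Vec (Fin n) n) c i → lookup (insert σ c) i ≡ extend (lookup σ) c i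
lookup-insert σ c = lookup∘tabulate (extend (lookup σ) c)

insert-IsPerm : ∀ (σ : Vec (Fin n) n) c → IsPerm σ → IsPerm (insert σ c)
insert-IsPerm σ c σ-perm = injective⇒IsPerm (insert σ c) λ {i} {j} eq →
  extend-injective (lookup σ) (IsPerm⇒injective σ σ-perm) c
    (trans (sym (lookup-insert σ c i)) (trans eq (lookup-insert σ c j)))

extend-cancelʳ : ∀ {f f′ : Fin n → Fin n} c c′ → (∀ i → extend f c i ≡ extend f′ c′ i) → c ≡ c′
extend-cancelʳ         nothing  nothing   _    = refl
extend-cancelʳ {n} {f} {f′} nothing (just a′) ext≗ =
  contradiction (trans (sym (extend-top-nothing f)) (trans (ext≗ (fromℕ n)) (extend-top-just f′ a′))) fromℕ≢inject₁
extend-cancelʳ {n} {f} {f′} (just a) nothing ext≗ =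
  contradiction (trans (sym (extend-top-nothing f′)) (trans (sym (ext≗ (fromℕ n))) (extend-top-just f a))) fromℕ≢inject₁
extend-cancelʳ {n} {f} {f′} (just a) (just a′) ext≗ with a ≟ᶠ a′
... | yes refl = refl
... | no a≢a′  = contradiction
  (trans (sym (extend-inject₁-hit f a)) (trans (ext≗ (inject₁ a)) (extend-inject₁ f′ (just a′) a (a≢a′ ∘ just-injective ∘ sym))))
  fromℕ≢inject₁

extend-cancelˡ : ∀ {f f′ : Fin n → Fin n} c → (∀ i → extend f c i ≡ extend f′ c i) → ∀ j → f j ≡ f′ j
extend-cancelˡ {n} {f} {f′} c ext≗ j with c ≟ᴹ just j
... | yes refl = inject₁-injective (trans (sym (extend-top-just f j)) (trans (ext≗ (fromℕ n)) (extend-top-just f′ j)))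
... | no c≢j   = inject₁-injective (trans (sym (extend-inject₁ f c j c≢j)) (trans (ext≗ (inject₁ j)) (extend-inject₁ f′ c j c≢j)))

insert-≡⇒extend-≗ : ∀ (σ σ′ : Vec (Fin n) n) c c′ → insert σ c ≡ insert σ′ c′ →
                    ∀ i → extend (lookup σ) c i ≡ extend (lookup σ′) c′ i
insert-≡⇒extend-≗ σ σ′ c c′ eq i =
  trans (sym (lookup-insert σ c i)) (trans (cong (λ v → lookup v i) eq) (lookup-insert σ′ c′ i))

insert-injective : ∀ {σ σ′ : Vec (Fin n) n} {c c′} → insert σ c ≡ insert σ′ c′ → σ ≡ σ′ × c ≡ c′
insert-injective {σ = σ} {σ′} {c} {c′} eq
  with refl ← extend-cancelʳ c c′ (insert-≡⇒extend-≗ σ σ′ c c′ eq) =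
  ≗⇒≡ (extend-cancelˡ c (insert-≡⇒extend-≗ σ σ′ c c eq)) , refl

injective⇒hits-top : ∀ (F : Fin (suc n) → Fin (suc n)) → Injective _≡_ _≡_ F → ∃ λ b → F b ≡ fromℕ n
injective⇒hits-top {n} F F-inj with any? (λ b → F b ≟ᶠ fromℕ n)
... | yes hit = hit
... | no ¬hit -- then F would inject Fin (suc n) into Fin n
  with _ , _ , i<j , eq ← pigeonhole (n<1+n n) (λ b →
         lower₁ (F b) λ n≡Fb → ¬hit (b , toℕ-injective (trans (sym n≡Fb) (sym (toℕ-fromℕ n)))))
  = contradiction (cong toℕ (F-inj (lower₁-injective eq))) (<⇒≢ i<j)

data TopPreimage (F : Fin (suc n) → Fin (suc n)) : Maybe (Fin n) → Set where
  top-fixed : F (fromℕ n) ≡ fromℕ n → TopPreimage F nothing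
  top-after : ∀ a → F (inject₁ a) ≡ fromℕ n → TopPreimage F (just a)

topPreimage : ∀ (F : Fin (suc n) → Fin (suc n)) → Injective _≡_ _≡_ F → ∃ (TopPreimage F)
topPreimage F F-inj with injective⇒hits-top F F-inj
... | b , Fb≡top with view b
...   | ‵fromℕ     = nothing , top-fixed Fb≡top
...   | ‵inject₁ a = just a , top-after a Fb≡top

skip : Maybe (Fin n) → Fin n → Fin (suc n)
skip {n} c j with c ≟ᴹ just j
... | yes _ = fromℕ n
... | no  _ = inject₁ j

skip-hit : ∀ (a : Fin n) → skip (just a) a ≡ fromℕ n
skip-hit a with just a ≟ᴹ just a
... | yes _  = refl
... | no a≢a = contradiction refl a≢a

skip-miss : ∀ {c} {j : Fin n} → c ≢ just j → skip c j ≡ inject₁ j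
skip-miss {c = c} {j} c≢j with c ≟ᴹ just j
... | yes c≡j = contradiction c≡j c≢j
... | no  _   = refl

skip-injective : ∀ (c : Maybe (Fin n)) → Injective _≡_ _≡_ (skip c)
skip-injective c {j} {k} eq with c ≟ᴹ just j | c ≟ᴹ just k
... | yes c≡j | yes c≡k = just-injective (trans (sym c≡j) c≡k)
... | yes _   | no  _   = contradiction eq fromℕ≢inject₁
... | no  _   | yes _   = contradiction (sym eq) fromℕ≢inject₁
... | no  _   | no  _   = inject₁-injective eq

module Removal {F : Fin (suc n) → Fin (suc n)} (F-inj : Injective _≡_ _≡_ F) where

  F∘skip≢top : ∀ {c} → TopPreimage F c → ∀ j → F (skip c j) ≢ fromℕ n
  F∘skip≢top (top-fixed F-top) j eq = fromℕ≢inject₁ (sym (F-inj (trans eq (sym F-top))))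
  F∘skip≢top (top-after a F-a) j eq with a ≟ᶠ j
  ... | yes refl = fromℕ≢inject₁ (F-inj (trans eq (sym F-a)))
  ... | no a≢j   = a≢j (inject₁-injective (F-inj (trans F-a (sym eq))))

  -- the top is cut out of its cycle: its predecessor is sent to F (top) instead
  removed : ∀ {c} → TopPreimage F c → Vec (Fin n) n
  removed {c} spec = tabulate λ j →
    lower₁ (F (skip c j)) λ n≡Fj → F∘skip≢top spec j (toℕ-injective (trans (sym n≡Fj) (sym (toℕ-fromℕ n))))

  inject₁-removed : ∀ {c} (spec : TopPreimage F c) j → inject₁ (lookup (removed spec) j) ≡ F (skip c j)
  inject₁-removed spec j = trans (cong inject₁ (lookup∘tabulate _ j)) (inject₁-lower₁ _ _)

  removed-IsPerm : ∀ {c} (spec : TopPreimage F c) → IsPerm (removed spec)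
  removed-IsPerm {c} spec = injective⇒IsPerm (removed spec) λ {j} {k} eq →
    skip-injective c (F-inj (trans (sym (inject₁-removed spec j)) (trans (cong inject₁ eq) (inject₁-removed spec k))))

  extend-removed : ∀ {c} (spec : TopPreimage F c) i → F i ≡ extend (lookup (removed spec)) c i
  extend-removed spec i = go spec (view i)
    where
    go : ∀ {c i} (spec : TopPreimage F c) → View i → F i ≡ extend (lookup (removed spec)) c i
    go (top-fixed F-top) ‵fromℕ = trans F-top (sym (extend-top-nothing _))
    go (top-after a F-a) ‵fromℕ = trans (cong F (sym (skip-hit a)))
      (trans (sym (inject₁-removed (top-after a F-a) a)) (sym (extend-top-just _ a)))
    go {c} spec (‵inject₁ j) with c ≟ᴹ just j
    go (top-after a F-a) (‵inject₁ a) | yes refl = trans F-a (sym (extend-inject₁-hit _ a))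
    go {c} spec (‵inject₁ j) | no c≢j = trans (cong F (sym (skip-miss c≢j)))
      (trans (sym (inject₁-removed spec j)) (sym (extend-inject₁ _ c j c≢j)))

insert-surjective : ∀ (σ′ : Vec (Fin (suc n)) (suc n)) → IsPerm σ′ →
                    ∃ λ σ → ∃ λ c → IsPerm σ × σ′ ≡ insert σ c
insert-surjective σ′ σ′-perm with topPreimage (lookup σ′) (IsPerm⇒injective σ′ σ′-perm)
... | c , spec = removed spec , c , removed-IsPerm spec ,
                 ≗⇒≡ λ i → trans (extend-removed spec i) (sym (lookup-insert (removed spec) c i))
  where open Removal (IsPerm⇒injective σ′ σ′-perm)

options : ∀ n → List (Maybe (Fin n))
options n = nothing ∷ map just (allFin n)

options-unique : ∀ n → Unique (options n)
options-unique n = All.tabulate (λ x∈ → nothing≢just (∈-map⁻ just x∈)) ∷ map⁺ just-injective (allFin⁺ n)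
  where nothing≢just : ∀ {x} → ∃ (λ a → _ × x ≡ just a) → nothing ≢ x
        nothing≢just (_ , _ , refl) ()

∈-options : ∀ (c : Maybe (Fin n)) → c ∈ options n
∈-options nothing  = here refl
∈-options (just a) = there (∈-map⁺ just (∈-allFin a))

∑-perms-suc : ∀ n (g : Vec (Fin (suc n)) (suc n) → ℕ) →
              ∑ g (perms (suc n)) ≡ ∑ (λ σ → ∑ (λ c → g (insert σ c)) (options n)) (perms n)
∑-perms-suc n g = trans (∑-↭ g perms↭insertions) (∑-cartesianProductWith g insert (perms n) (options n))
  where
  insertions = cartesianProductWith insert (perms n) (options n)
  perms↭insertions : perms (suc n) ↭ insertions
  perms↭insertions = unique-⊆⊇⇒↭ (perms-unique (suc n))
    (cartesianProductWith⁺ insert insert-injective (perms-unique n) (options-unique n))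
    (λ σ′∈ → case insert-surjective _ (∈-perms⁻ σ′∈) of λ where
      (σ , c , σ-perm , refl) → ∈-cartesianProductWith⁺ insert (∈-perms⁺ σ-perm) (∈-options c))
    (λ σ′∈ → case ∈-cartesianProductWith⁻ insert (perms n) (options n) σ′∈ of λ where
      (σ , c , σ∈ , _ , refl) → ∈-perms⁺ (insert-IsPerm σ c (∈-perms⁻ σ∈)))

-- Cycles

module _ {p} {P : Pred ℕ p} (P? : Decidable P) where

  prefixLength : ℕ → (ℕ → ℕ) → ℕ
  prefixLength n f = length (takeWhile P? (applyUpTo f n))

  prefixLength≤ : ∀ n f → prefixLength n f ≤ n
  prefixLength≤ zero    f = z≤n
  prefixLength≤ (suc n) f with does (P? (f zero))
  ... | true  = s≤s (prefixLength≤ n (f ∘ suc))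
  ... | false = z≤n

  prefixLength-holds : ∀ n f m → m < prefixLength n f → P (f m)
  prefixLength-holds (suc n) f m       m< with P? (f zero)
  prefixLength-holds (suc n) f zero    _        | yes p = p
  prefixLength-holds (suc n) f (suc m) (s≤s m<) | yes _ = prefixLength-holds n (f ∘ suc) m m<

  prefixLength-fails : ∀ n f → prefixLength n f < n → ¬ P (f (prefixLength n f))
  prefixLength-fails (suc n) f ℓ<n with P? (f zero)
  prefixLength-fails (suc n) f (s≤s ℓ<n) | yes _  = prefixLength-fails n (f ∘ suc) ℓ<n
  prefixLength-fails (suc n) f _         | no ¬p = ¬p

argmin : ∀ {q} (h : Fin (suc q) → ℕ) → ∃ λ k → ∀ k′ → h k ≤ h k′
argmin {zero}  h = zero , λ { zero → ≤-refl }
argmin {suc q} h with argmin (h ∘ suc)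
... | k , hk≤ with h zero ≤? h (suc k)
...   | yes h0≤ = zero  , λ { zero → ≤-refl ; (suc k′) → ≤-trans h0≤ (hk≤ k′) }
...   | no  h0≰ = suc k , λ { zero → <⇒≤ (≰⇒> h0≰) ; (suc k′) → hk≤ k′ }

module Cycles (σ : Vec (Fin n) n) (σ-inj : Injective _≡_ _≡_ (lookup σ)) where

  iter-+ : ∀ a b i → iter σ (a + b) i ≡ iter σ a (iter σ b i)
  iter-+ zero    b i = refl
  iter-+ (suc a) b i = cong (lookup σ) (iter-+ a b i)

  iter-injective : ∀ a → Injective _≡_ _≡_ (iter σ a)
  iter-injective zero    eq = eq
  iter-injective (suc a) eq = iter-injective a (σ-inj eq)

  iter-∸ : ∀ {a b} i → a < b → iter σ a i ≡ iter σ b i → iter σ (b ∸ a) i ≡ i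
  iter-∸ {a} {b} i a<b eq = sym (iter-injective a (trans eq (trans
    (cong (λ t → iter σ t i) (sym (trans (+-comm a (b ∸ a)) (m∸n+n≡m (<⇒≤ a<b))))) (iter-+ a (b ∸ a) i))))

  returns : ∀ i → ∃ λ d → 0 < d × d ≤ n × iter σ d i ≡ i
  returns i with pigeonhole (n<1+n n) (λ k → iter σ (toℕ k) i)
  ... | k₁ , k₂ , k₁<k₂ , eq = toℕ k₂ ∸ toℕ k₁ , m<n⇒0<n∸m k₁<k₂ ,
    ≤-trans (m∸n≤m (toℕ k₂) (toℕ k₁)) (s≤s⁻¹ (toℕ<n k₂)) , iter-∸ i k₁<k₂ eq

  -- cycleLen σ i is 1 + prefixLength (notReturned? i) n id by definition
  private
    NotReturned : Fin n → ℕ → Set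
    NotReturned i m = iter σ (suc m) i ≢ i

    notReturned? : ∀ i → Decidable (NotReturned i)
    notReturned? i m = ¬? (iter σ (suc m) i ≟ᶠ i)

  cycleLen≤n : ∀ i → cycleLen σ i ≤ n
  cycleLen≤n i with m≤n⇒m<n∨m≡n (prefixLength≤ (notReturned? i) n id)
  ... | inj₁ ℓ<n = ℓ<n
  ... | inj₂ ℓ≡n with returns i
  ...   | suc d , _ , d<n , σᵈi≡i =
    contradiction σᵈi≡i (prefixLength-holds (notReturned? i) n id d (subst (d <_) (sym ℓ≡n) d<n))

  iter-cycleLen : ∀ i → iter σ (cycleLen σ i) i ≡ i
  iter-cycleLen i = decidable-stable (iter σ (cycleLen σ i) i ≟ᶠ i)
    (prefixLength-fails (notReturned? i) n id (cycleLen≤n i))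

  iter<cycleLen : ∀ i m → 0 < m → m < cycleLen σ i → iter σ m i ≢ i
  iter<cycleLen i (suc m) _ (s≤s m<ℓ) = prefixLength-holds (notReturned? i) n id m m<ℓ

  cycleLen-unique : ∀ i p → 0 < p → iter σ p i ≡ i → (∀ m → 0 < m → m < p → iter σ m i ≢ i) → cycleLen σ i ≡ p
  cycleLen-unique i p 0<p σᵖi≡i minimal with <-cmp (cycleLen σ i) p
  ... | tri≈ _ ℓ≡p _ = ℓ≡p
  ... | tri< ℓ<p _ _ = contradiction (iter-cycleLen i) (minimal (cycleLen σ i) (s≤s z≤n) ℓ<p)
  ... | tri> _ _ p<ℓ = contradiction σᵖi≡i (iter<cycleLen i p 0<p p<ℓ)

  iter-*cycleLen : ∀ i k → iter σ (k * cycleLen σ i) i ≡ i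
  iter-*cycleLen i zero    = refl
  iter-*cycleLen i (suc k) = trans (iter-+ (cycleLen σ i) (k * cycleLen σ i) i)
    (trans (cong (iter σ (cycleLen σ i)) (iter-*cycleLen i k)) (iter-cycleLen i))

  iter-%cycleLen : ∀ i j → iter σ j i ≡ iter σ (j % cycleLen σ i) i
  iter-%cycleLen i j = trans (cong (λ t → iter σ t i) (m≡m%n+[m/n]*n j (cycleLen σ i)))
    (trans (iter-+ (j % cycleLen σ i) _ i) (cong (iter σ (j % cycleLen σ i)) (iter-*cycleLen i (j / cycleLen σ i))))

  iter-injective-on-cycle : ∀ x j j′ → j < cycleLen σ x → j′ < cycleLen σ x → iter σ j x ≡ iter σ j′ x → j ≡ j′
  iter-injective-on-cycle x j j′ j<ℓ j′<ℓ eq with <-cmp j j′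
  ... | tri≈ _ j≡j′ _ = j≡j′
  ... | tri< j<j′ _ _ = contradiction (iter-∸ x j<j′ eq)
    (iter<cycleLen x (j′ ∸ j) (m<n⇒0<n∸m j<j′) (≤-<-trans (m∸n≤m j′ j) j′<ℓ))
  ... | tri> _ _ j′<j = contradiction (iter-∸ x j′<j (sym eq))
    (iter<cycleLen x (j ∸ j′) (m<n⇒0<n∸m j′<j) (≤-<-trans (m∸n≤m j j′) j<ℓ))

  IsCycleMin⇒ : ∀ {m} → IsCycleMin σ m → ∀ j → toℕ m ≤ toℕ (iter σ j m)
  IsCycleMin⇒ {m} m-min j = subst (λ x → toℕ m ≤ toℕ x) (sym (iter-%cycleLen m j))
    (applyUpTo⁻ id n m-min (≤-trans (m%n<n j (cycleLen σ m)) (cycleLen≤n m)))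

  IsCycleMin⁺ : ∀ {m} → (∀ j → toℕ m ≤ toℕ (iter σ j m)) → IsCycleMin σ m
  IsCycleMin⁺ m≤ = applyUpTo⁺₂ id n m≤

  SameCycle : Fin n → Fin n → Set
  SameCycle x y = ∃ λ j → iter σ j x ≡ y

  SameCycle-trans : ∀ {x y z} → SameCycle x y → SameCycle y z → SameCycle x z
  SameCycle-trans (j , refl) (k , refl) = k + j , iter-+ k j _

  SameCycle-sym : ∀ {x y} → SameCycle x y → SameCycle y x
  SameCycle-sym {x} (j , refl) = j * cycleLen σ x ∸ j , (begin
    iter σ (j * cycleLen σ x ∸ j) (iter σ j x) ≡⟨ iter-+ (j * cycleLen σ x ∸ j) j x ⟨
    iter σ (j * cycleLen σ x ∸ j + j) x        ≡⟨ cong (λ t → iter σ t x) (m∸n+n≡m (m≤m*n j (cycleLen σ x))) ⟩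
    iter σ (j * cycleLen σ x) x                ≡⟨ iter-*cycleLen x j ⟩
    x                                          ∎)

  -- the exponent can be taken below the cycle length, which makes SameCycle decidable
  SameCycleᶠ : Fin n → Fin n → Set
  SameCycleᶠ x y = ∃ λ (k : Fin (cycleLen σ x)) → iter σ (toℕ k) x ≡ y

  sameCycleᶠ? : ∀ x y → Dec (SameCycleᶠ x y)
  sameCycleᶠ? x y = any? (λ k → iter σ (toℕ k) x ≟ᶠ y)

  SameCycleᶠ⇒SameCycle : ∀ {x y} → SameCycleᶠ x y → SameCycle x y
  SameCycleᶠ⇒SameCycle (k , eq) = toℕ k , eq

  SameCycle⇒SameCycleᶠ : ∀ {x y} → SameCycle x y → SameCycleᶠ x y
  SameCycle⇒SameCycleᶠ {x} (j , refl) = fromℕ< j%ℓ<ℓ ,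
    trans (cong (λ t → iter σ t x) (toℕ-fromℕ< j%ℓ<ℓ)) (sym (iter-%cycleLen x j))
    where j%ℓ<ℓ = m%n<n j (cycleLen σ x)

  cycleMin : ∀ a → ∃ λ m → IsCycleMin σ m × SameCycle m a
  cycleMin a with argmin {cycleLen σ a ∸ 1} (λ k → toℕ (iter σ (toℕ k) a))
  ... | k , min = m , IsCycleMin⁺ m≤ , SameCycle-sym (toℕ k , refl)
    where
    m = iter σ (toℕ k) a
    m≤ : ∀ j → toℕ m ≤ toℕ (iter σ j m)
    m≤ j with SameCycle⇒SameCycleᶠ (j + toℕ k , refl)
    ... | k′ , eq = subst (λ x → toℕ m ≤ toℕ x) (trans eq (iter-+ j (toℕ k) a)) (min k′)

  cycleMin-unique : ∀ {m₁ m₂} → IsCycleMin σ m₁ → IsCycleMin σ m₂ → SameCycle m₁ m₂ → m₁ ≡ m₂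
  cycleMin-unique {m₁} {m₂} m₁-min m₂-min m₁~m₂@(j , eq) with SameCycle-sym m₁~m₂
  ... | j′ , eq′ = toℕ-injective (≤-antisym
    (subst (λ x → toℕ m₁ ≤ toℕ x) eq (IsCycleMin⇒ m₁-min j))
    (subst (λ x → toℕ m₂ ≤ toℕ x) eq′ (IsCycleMin⇒ m₂-min j′)))

  cycle-size : ∀ x → ∑ (λ y → 𝟙 (sameCycleᶠ? x y)) (allFin n) ≡ cycleLen σ x
  cycle-size x = begin
    ∑ (λ y → 𝟙 (sameCycleᶠ? x y)) (allFin n) ≡⟨ length-filter≡∑𝟙 (sameCycleᶠ? x) (allFin n) ⟨
    length (filter (sameCycleᶠ? x) (allFin n)) ≡⟨ ↭-length cycle↭orbit ⟩
    length orbit                               ≡⟨ length-map _ (allFin (cycleLen σ x)) ⟩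
    length (allFin (cycleLen σ x))             ≡⟨ length-tabulate id ⟩
    cycleLen σ x                               ∎
    where
    orbit : List (Fin n)
    orbit = map (λ k → iter σ (toℕ k) x) (allFin (cycleLen σ x))
    cycle↭orbit : filter (sameCycleᶠ? x) (allFin n) ↭ orbit
    cycle↭orbit = unique-⊆⊇⇒↭ (filter⁺ (sameCycleᶠ? x) (allFin⁺ n))
      (map⁺ (λ eq → toℕ-injective (iter-injective-on-cycle x _ _ (toℕ<n _) (toℕ<n _) eq)) (allFin⁺ _))
      (λ y∈ → case ∈-filter⁻ (sameCycleᶠ? x) {xs = allFin n} y∈ of λ where
        (_ , k , refl) → ∈-map⁺ (λ k → iter σ (toℕ k) x) (∈-allFin k))
      (λ y∈ → case ∈-map⁻ (λ k → iter σ (toℕ k) x) {xs = allFin (cycleLen σ x)} y∈ of λ where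
        (k , _ , refl) → ∈-filter⁺ (sameCycleᶠ? x) (∈-allFin _) (k , refl))

-- Counting permutations by ordered cycle structure

filter-map : ∀ {P : B → Set} {Q : A → Set} (P? : Decidable P) (Q? : Decidable Q) (g : A → B) →
             (∀ x → P (g x) → Q x) → (∀ x → Q x → P (g x)) → ∀ xs → filter P? (map g xs) ≡ map g (filter Q? xs)
filter-map P? Q? g P⇒Q Q⇒P [] = refl
filter-map P? Q? g P⇒Q Q⇒P (x ∷ xs) with P? (g x) | Q? x
... | yes _  | yes _  = cong (g x ∷_) (filter-map P? Q? g P⇒Q Q⇒P xs)
... | yes p  | no ¬q  = contradiction (P⇒Q x p) ¬q
... | no ¬p  | yes q  = contradiction (Q⇒P x q) ¬p
... | no _   | no _   = filter-map P? Q? g P⇒Q Q⇒P xs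

allFin-suc : ∀ n → allFin (suc n) ≡ map inject₁ (allFin n) ++ [ fromℕ n ]
allFin-suc n = trans (tabulate-∷ʳ n id) (cong (_++ [ fromℕ n ]) (sym (map-tabulate id inject₁)))
  where
  tabulate-∷ʳ : ∀ n (g : Fin (suc n) → A) → List.tabulate g ≡ List.tabulate (g ∘ inject₁) ++ [ g (fromℕ n) ]
  tabulate-∷ʳ zero    g = refl
  tabulate-∷ʳ (suc n) g = cong (g zero ∷_) (tabulate-∷ʳ n (g ∘ suc))

module CyclesAfterInsertion (σ : Vec (Fin n) n) (σ-perm : IsPerm σ) (c : Maybe (Fin n)) where

  private
    f = lookup σ
    σ′ = insert σ c
    top = fromℕ n
    module C = Cycles σ (IsPerm⇒injective σ σ-perm)
    module C′ = Cycles σ′ (IsPerm⇒injective σ′ (insert-IsPerm σ c σ-perm))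

  σ′-miss : ∀ x → c ≢ just x → lookup σ′ (inject₁ x) ≡ inject₁ (f x)
  σ′-miss x c≢x = trans (lookup-insert σ c (inject₁ x)) (extend-inject₁ f c x c≢x)

  σ′-hit : ∀ x → c ≡ just x → lookup σ′ (inject₁ x) ≡ top
  σ′-hit x refl = trans (lookup-insert σ c (inject₁ x)) (extend-inject₁-hit f x)

  σ′-top-just : ∀ a → c ≡ just a → lookup σ′ top ≡ inject₁ (f a)
  σ′-top-just a refl = trans (lookup-insert σ c top) (extend-top-just f a)

  σ′-top-nothing : c ≡ nothing → lookup σ′ top ≡ top
  σ′-top-nothing refl = trans (lookup-insert σ c top) (extend-top-nothing f)

  orbit-forward : ∀ i j → (∃ λ j′ → iter σ′ j (inject₁ i) ≡ inject₁ (iter σ j′ i))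
                         ⊎ (iter σ′ j (inject₁ i) ≡ top × ∃ λ j′ → c ≡ just (iter σ j′ i))
  orbit-forward i zero = inj₁ (0 , refl)
  orbit-forward i (suc j) with orbit-forward i j
  ... | inj₂ (eq , j′ , hit) = inj₁ (suc j′ , trans (cong (lookup σ′) eq) (σ′-top-just _ hit))
  ... | inj₁ (j′ , eq) with c ≟ᴹ just (iter σ j′ i)
  ...   | yes hit  = inj₂ (trans (cong (lookup σ′) eq) (σ′-hit _ hit) , j′ , hit)
  ...   | no  miss = inj₁ (suc j′ , trans (cong (lookup σ′) eq) (σ′-miss _ miss))

  orbit-backward : ∀ i j′ → ∃ λ j → iter σ′ j (inject₁ i) ≡ inject₁ (iter σ j′ i)
  orbit-backward i zero = 0 , refl
  orbit-backward i (suc j′) with orbit-backward i j′ | c ≟ᴹ just (iter σ j′ i)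
  ... | j , eq | yes hit  = suc (suc j) ,
    trans (cong (lookup σ′ ∘ lookup σ′) eq) (trans (cong (lookup σ′) (σ′-hit _ hit)) (σ′-top-just _ hit))
  ... | j , eq | no  miss = suc j , trans (cong (lookup σ′) eq) (σ′-miss _ miss)

  IsCycleMin-inject₁⁺ : ∀ i → IsCycleMin σ i → IsCycleMin σ′ (inject₁ i)
  IsCycleMin-inject₁⁺ i i-min = C′.IsCycleMin⁺ i≤
    where
    i≤ : ∀ j → toℕ (inject₁ i) ≤ toℕ (iter σ′ j (inject₁ i))
    i≤ j with orbit-forward i j
    ... | inj₁ (j′ , eq) rewrite eq | toℕ-inject₁ i | toℕ-inject₁ (iter σ j′ i) = C.IsCycleMin⇒ i-min j′
    ... | inj₂ (eq , _)  rewrite eq | toℕ-inject₁ i | toℕ-fromℕ n = <⇒≤ (toℕ<n i)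

  IsCycleMin-inject₁⁻ : ∀ i → IsCycleMin σ′ (inject₁ i) → IsCycleMin σ i
  IsCycleMin-inject₁⁻ i i-min = C.IsCycleMin⁺ λ j′ → case orbit-backward i j′ of λ where
    (j , eq) → subst₂ _≤_ (toℕ-inject₁ i) (trans (cong toℕ eq) (toℕ-inject₁ _)) (C′.IsCycleMin⇒ i-min j)

  IsCycleMin-top : c ≡ nothing → IsCycleMin σ′ top
  IsCycleMin-top c≡nothing = C′.IsCycleMin⁺ λ j → ≤-reflexive (cong toℕ (sym (iter-top j)))
    where
    iter-top : ∀ j → iter σ′ j top ≡ top
    iter-top zero    = refl
    iter-top (suc j) = trans (cong (lookup σ′) (iter-top j)) (σ′-top-nothing c≡nothing)

  ¬IsCycleMin-top : ∀ a → c ≡ just a → ¬ IsCycleMin σ′ top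
  ¬IsCycleMin-top a c≡a top-min = <⇒≱ σ′top<top (C′.IsCycleMin⇒ top-min 1)
    where
    σ′top<top : toℕ (iter σ′ 1 top) < toℕ top
    σ′top<top rewrite σ′-top-just a c≡a | toℕ-inject₁ (f a) | toℕ-fromℕ n = toℕ<n (f a)

  cycleLen-top : c ≡ nothing → cycleLen σ′ top ≡ 1
  cycleLen-top c≡nothing = C′.cycleLen-unique top 1 (s≤s z≤n) (σ′-top-nothing c≡nothing) λ where
    (suc m) _ (s≤s ())

  cycleLen-miss : ∀ i → (∀ j → c ≢ just (iter σ j i)) → cycleLen σ′ (inject₁ i) ≡ cycleLen σ i
  cycleLen-miss i miss = C′.cycleLen-unique (inject₁ i) (cycleLen σ i) (s≤s z≤n)
    (trans (orbit≡ (cycleLen σ i)) (cong inject₁ (C.iter-cycleLen i)))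
    (λ m 0<m m<ℓ eq → C.iter<cycleLen i m 0<m m<ℓ (inject₁-injective (trans (sym (orbit≡ m)) eq)))
    where
    orbit≡ : ∀ j → iter σ′ j (inject₁ i) ≡ inject₁ (iter σ j i)
    orbit≡ zero    = refl
    orbit≡ (suc j) = trans (cong (lookup σ′) (orbit≡ j)) (σ′-miss _ (miss j))

  cycleLen-hit : ∀ i q → q < cycleLen σ i → c ≡ just (iter σ q i) → cycleLen σ′ (inject₁ i) ≡ suc (cycleLen σ i)
  cycleLen-hit i q q<ℓ hit = C′.cycleLen-unique (inject₁ i) (suc ℓ) (s≤s z≤n)
    (trans (after ℓ q<ℓ ≤-refl) (cong inject₁ (C.iter-cycleLen i))) minimal
    where
    ℓ = cycleLen σ i
    G : ℕ → Fin (suc n)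
    G j = iter σ′ j (inject₁ i)
    miss : ∀ j → j < ℓ → j ≢ q → c ≢ just (iter σ j i)
    miss j j<ℓ j≢q c≡j = j≢q (C.iter-injective-on-cycle i j q j<ℓ q<ℓ (just-injective (trans (sym c≡j) hit)))
    before : ∀ j → j ≤ q → G j ≡ inject₁ (iter σ j i)
    before zero    _     = refl
    before (suc j) j<q = trans (cong (lookup σ′) (before j (<⇒≤ j<q))) (σ′-miss _ (miss j (<-trans j<q q<ℓ) (<⇒≢ j<q)))
    at : G (suc q) ≡ top
    at = trans (cong (lookup σ′) (before q ≤-refl)) (σ′-hit _ hit)
    after : ∀ j → q < j → j ≤ ℓ → G (suc j) ≡ inject₁ (iter σ j i)
    after (suc j) q<1+j 1+j≤ℓ with m≤n⇒m<n∨m≡n (s≤s⁻¹ q<1+j)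
    ... | inj₂ refl = trans (cong (lookup σ′) at) (σ′-top-just _ hit)
    ... | inj₁ q<j  = trans (cong (lookup σ′) (after j q<j (<⇒≤ 1+j≤ℓ)))
                            (σ′-miss _ (miss j 1+j≤ℓ (≢-sym (<⇒≢ q<j))))
    minimal : ∀ m → 0 < m → m < suc ℓ → G m ≢ inject₁ i
    minimal m 0<m m<1+ℓ eq with <-cmp m (suc q)
    ... | tri< m<1+q _ _ = C.iter<cycleLen i m 0<m (≤-trans m<1+q q<ℓ)
                             (inject₁-injective (trans (sym (before m (s≤s⁻¹ m<1+q))) eq))
    ... | tri≈ _ refl _  = fromℕ≢inject₁ (trans (sym at) eq)
    minimal (suc m) _ m<1+ℓ eq | tri> _ _ 1+q<1+m =
      C.iter<cycleLen i m (≤-trans (s≤s z≤n) (s≤s⁻¹ 1+q<1+m)) (s≤s⁻¹ m<1+ℓ)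
        (inject₁-injective (trans (sym (after m (s≤s⁻¹ 1+q<1+m) (<⇒≤ (s≤s⁻¹ m<1+ℓ)))) eq))

  cycleLen-insert-nothing : c ≡ nothing → ∀ i → cycleLen σ′ (inject₁ i) ≡ cycleLen σ i
  cycleLen-insert-nothing refl i = cycleLen-miss i λ _ ()

  cycleLen-insert-just : ∀ a → c ≡ just a → ∀ i → cycleLen σ′ (inject₁ i) ≡ cycleLen σ i + 𝟙 (C.sameCycleᶠ? i a)
  cycleLen-insert-just a c≡a i with C.sameCycleᶠ? i a
  ... | yes i~a@(k , σᵏi≡a) = begin
    cycleLen σ′ (inject₁ i) ≡⟨ cycleLen-hit i (toℕ k) (toℕ<n k) (trans c≡a (cong just (sym σᵏi≡a))) ⟩
    suc (cycleLen σ i)      ≡⟨ +-comm 1 _ ⟩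
    cycleLen σ i + 1        ≡⟨ cong (cycleLen σ i +_) (𝟙-yes (yes i~a) i~a) ⟨
    cycleLen σ i + 𝟙 (yes i~a) ∎
  ... | no i≁a = begin
    cycleLen σ′ (inject₁ i)    ≡⟨ cycleLen-miss i (λ j c≡σʲi → i≁a (C.SameCycle⇒SameCycleᶠ (j , just-injective (trans (sym c≡σʲi) c≡a)))) ⟩
    cycleLen σ i               ≡⟨ +-identityʳ _ ⟨
    cycleLen σ i + 0           ≡⟨ cong (cycleLen σ i +_) (𝟙-no (no i≁a) i≁a) ⟨
    cycleLen σ i + 𝟙 (no i≁a)  ∎

  private
    minima = filter (isCycleMin? σ) (allFin n)
    topType = map (cycleLen σ′) (filter (isCycleMin? σ′) [ top ])

  cycleType-insert : cycleType σ′ ≡ map (cycleLen σ′ ∘ inject₁) minima ++ topType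
  cycleType-insert = begin
    map (cycleLen σ′) (filter (isCycleMin? σ′) (allFin (suc n)))
      ≡⟨ cong (map (cycleLen σ′) ∘ filter (isCycleMin? σ′)) (allFin-suc n) ⟩
    map (cycleLen σ′) (filter (isCycleMin? σ′) (map inject₁ (allFin n) ++ [ top ]))
      ≡⟨ cong (map (cycleLen σ′)) (filter-++ (isCycleMin? σ′) (map inject₁ (allFin n)) [ top ]) ⟩
    map (cycleLen σ′) (filter (isCycleMin? σ′) (map inject₁ (allFin n)) ++ filter (isCycleMin? σ′) [ top ])
      ≡⟨ map-++ (cycleLen σ′) (filter (isCycleMin? σ′) (map inject₁ (allFin n))) _ ⟩
    map (cycleLen σ′) (filter (isCycleMin? σ′) (map inject₁ (allFin n))) ++ topType
      ≡⟨ cong (λ xs → map (cycleLen σ′) xs ++ topType)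
              (filter-map (isCycleMin? σ′) (isCycleMin? σ) inject₁ IsCycleMin-inject₁⁻ IsCycleMin-inject₁⁺ (allFin n)) ⟩
    map (cycleLen σ′) (map inject₁ minima) ++ topType
      ≡⟨ cong (_++ topType) (map-∘ minima) ⟨
    map (cycleLen σ′ ∘ inject₁) minima ++ topType
      ∎

  cycleType-insert-nothing : c ≡ nothing → cycleType σ′ ≡ cycleType σ ++ [ 1 ]
  cycleType-insert-nothing c≡nothing = trans cycleType-insert (cong₂ _++_
    (map-cong (cycleLen-insert-nothing c≡nothing) minima)
    (trans (cong (map (cycleLen σ′)) (filter-accept (isCycleMin? σ′) (IsCycleMin-top c≡nothing))) (cong [_] (cycleLen-top c≡nothing))))

  cycleType-insert-just : ∀ a → c ≡ just a → cycleType σ′ ≡ map (λ m → cycleLen σ m + 𝟙 (C.sameCycleᶠ? m a)) minima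
  cycleType-insert-just a c≡a = trans cycleType-insert (trans (cong₂ _++_
    (map-cong (cycleLen-insert-just a c≡a) minima)
    (cong (map (cycleLen σ′)) (filter-reject (isCycleMin? σ′) (¬IsCycleMin-top a c≡a)))) (++-identityʳ _))

-- incrementSum Φ (l₁ ∷ … ∷ lₖ) = ∑ᵢ lᵢ · Φ (l₁ ∷ … ∷ (lᵢ + 1) ∷ … ∷ lₖ)
incrementSum : (List ℕ → ℕ) → List ℕ → ℕ
incrementSum Φ []      = 0
incrementSum Φ (l ∷ L) = l * Φ (suc l ∷ L) + incrementSum (Φ ∘ (l ∷_)) L

insertionSum : (List ℕ → ℕ) → List ℕ → ℕ
insertionSum Φ L = Φ (L ++ [ 1 ]) + incrementSum Φ L

∑-incrementAt : ∀ (_≟_ : DecidableEquality A) (len : A → ℕ) (Φ : List ℕ → ℕ) xs → Unique xs →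
  ∑ (λ x → len x * Φ (map (λ y → len y + 𝟙 (y ≟ x)) xs)) xs ≡ incrementSum Φ (map len xs)
∑-incrementAt _≟_ len Φ []       _            = refl
∑-incrementAt _≟_ len Φ (x ∷ xs) (x∉xs ∷ !xs) = cong₂ _+_ head≡ tail≡
  where
  x≢ : ∀ {y} → y ∈ xs → x ≢ y
  x≢ = All.lookup x∉xs
  head≡ : len x * Φ ((len x + 𝟙 (x ≟ x)) ∷ map (λ y → len y + 𝟙 (y ≟ x)) xs) ≡ len x * Φ (suc (len x) ∷ map len xs)
  head≡ = cong (λ L → len x * Φ L) (cong₂ _∷_
    (trans (cong (len x +_) (𝟙-yes (x ≟ x) refl)) (+-comm (len x) 1))
    (map-cong-local (All.tabulate λ y∈ → trans (cong (len _ +_) (𝟙-no (_ ≟ x) (x≢ y∈ ∘ sym))) (+-identityʳ _))))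
  tail≡ : ∑ (λ y → len y * Φ ((len x + 𝟙 (x ≟ y)) ∷ map (λ z → len z + 𝟙 (z ≟ y)) xs)) xs
        ≡ incrementSum (Φ ∘ (len x ∷_)) (map len xs)
  tail≡ = trans (∑-cong-∈ xs (λ {y} y∈ → cong (λ t → len y * Φ (t ∷ map (λ z → len z + 𝟙 (z ≟ y)) xs))
                  (trans (cong (len x +_) (𝟙-no (x ≟ y) (x≢ y∈))) (+-identityʳ _))))
                (∑-incrementAt _≟_ len (Φ ∘ (len x ∷_)) xs !xs)

module _ (σ : Vec (Fin n) n) (σ-perm : IsPerm σ) where

  private
    module C = Cycles σ (IsPerm⇒injective σ σ-perm)
    minima = filter (isCycleMin? σ) (allFin n)
    len = cycleLen σ
    grownAt : Fin n → List ℕ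
    grownAt x = map (λ m → len m + 𝟙 (m ≟ᶠ x)) minima

  sameCycleᶠ-as-𝟙≡ : ∀ a → ∃ λ m₀ → m₀ ∈ minima × (∀ {m} → m ∈ minima → 𝟙 (C.sameCycleᶠ? m a) ≡ 𝟙 (m ≟ᶠ m₀))
  sameCycleᶠ-as-𝟙≡ a with C.cycleMin a
  ... | m₀ , m₀-min , m₀~a = m₀ , ∈-filter⁺ (isCycleMin? σ) (∈-allFin m₀) m₀-min , λ {m} m∈ →
    𝟙-cong (C.sameCycleᶠ? m a) (m ≟ᶠ m₀)
      (λ m~a → C.cycleMin-unique (proj₂ (∈-filter⁻ (isCycleMin? σ) {xs = allFin n} m∈)) m₀-min
                 (C.SameCycle-trans (C.SameCycleᶠ⇒SameCycle m~a) (C.SameCycle-sym m₀~a)))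
      (λ { refl → C.SameCycle⇒SameCycleᶠ m₀~a })

  ∑-insert-just : ∀ (Φ : List ℕ → ℕ) →
    ∑ (λ a → Φ (map (λ m → len m + 𝟙 (C.sameCycleᶠ? m a)) minima)) (allFin n) ≡ incrementSum Φ (cycleType σ)
  ∑-insert-just Φ = begin
    ∑ (λ a → Φ (map (λ m → len m + 𝟙 (C.sameCycleᶠ? m a)) minima)) (allFin n)
      ≡⟨ ∑-cong pointwise (allFin n) ⟩
    ∑ (λ a → ∑ (λ m → 𝟙 (C.sameCycleᶠ? m a) * Φ (grownAt m)) minima) (allFin n)
      ≡⟨ ∑-comm (λ a m → 𝟙 (C.sameCycleᶠ? m a) * Φ (grownAt m)) (allFin n) minima ⟩
    ∑ (λ m → ∑ (λ a → 𝟙 (C.sameCycleᶠ? m a) * Φ (grownAt m)) (allFin n)) minima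
      ≡⟨ ∑-cong (λ m → trans (∑-*ʳ (Φ (grownAt m)) (λ a → 𝟙 (C.sameCycleᶠ? m a)) (allFin n))
                             (cong (_* Φ (grownAt m)) (C.cycle-size m))) minima ⟩
    ∑ (λ m → len m * Φ (grownAt m)) minima
      ≡⟨ ∑-incrementAt _≟ᶠ_ len Φ minima (filter⁺ (isCycleMin? σ) (allFin⁺ n)) ⟩
    incrementSum Φ (cycleType σ)
      ∎
    where
    pointwise : ∀ a → Φ (map (λ m → len m + 𝟙 (C.sameCycleᶠ? m a)) minima)
                    ≡ ∑ (λ m → 𝟙 (C.sameCycleᶠ? m a) * Φ (grownAt m)) minima
    pointwise a with sameCycleᶠ-as-𝟙≡ a
    ... | m₀ , m₀∈ , 𝟙≡ = begin
      Φ (map (λ m → len m + 𝟙 (C.sameCycleᶠ? m a)) minima) ≡⟨ cong Φ (map-cong-local (All.tabulate (cong (len _ +_) ∘ 𝟙≡))) ⟩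
      Φ (grownAt m₀)                                       ≡⟨ ∑-𝟙-≡ _≟ᶠ_ (Φ ∘ grownAt) minima (filter⁺ (isCycleMin? σ) (allFin⁺ n)) m₀∈ ⟨
      ∑ (λ m → 𝟙 (m ≟ᶠ m₀) * Φ (grownAt m)) minima         ≡⟨ ∑-cong-∈ minima (cong (_* _) ∘ sym ∘ 𝟙≡) ⟩
      ∑ (λ m → 𝟙 (C.sameCycleᶠ? m a) * Φ (grownAt m)) minima ∎

∑-perms-suc-cycleType : ∀ n (Φ : List ℕ → ℕ) →
  ∑ (Φ ∘ cycleType) (perms (suc n)) ≡ ∑ (insertionSum Φ ∘ cycleType) (perms n)
∑-perms-suc-cycleType n Φ = trans (∑-perms-suc n (Φ ∘ cycleType)) (∑-cong-∈ (perms n) λ {σ} σ∈ →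
  let open CyclesAfterInsertion σ (∈-perms⁻ σ∈) in
  cong₂ _+_ (cong Φ (cycleType-insert-nothing nothing refl))
    (trans (∑-map (λ c → Φ (cycleType (insert σ c))) just (allFin n))
    (trans (∑-cong (λ a → cong Φ (cycleType-insert-just (just a) a refl)) (allFin n))
           (∑-insert-just σ (∈-perms⁻ σ∈) Φ))))

_≟ₗ_ : DecidableEquality (List ℕ)
_≟ₗ_ = ≡-dec _≟_

δ : List ℕ → List ℕ → ℕ
δ X Y = 𝟙 (X ≟ₗ Y)

δ-refl : ∀ X → δ X X ≡ 1
δ-refl X = 𝟙-yes (X ≟ₗ X) refl

δ-≢ : ∀ {X Y} → X ≢ Y → δ X Y ≡ 0
δ-≢ {X} {Y} = 𝟙-no (X ≟ₗ Y)

δ-∷ : ∀ a b X Y → δ (a ∷ X) (b ∷ Y) ≡ 𝟙 (a ≟ b) * δ X Y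
δ-∷ a b X Y = trans (𝟙-cong ((a ∷ X) ≟ₗ (b ∷ Y)) ((a ≟ b) ×-dec (X ≟ₗ Y)) ∷-injective (uncurry (cong₂ _∷_)))
                    (𝟙-× (a ≟ b) (X ≟ₗ Y))

δ-[]-∷ : ∀ b Y → δ [] (b ∷ Y) ≡ 0
δ-[]-∷ b Y = δ-≢ λ ()

δ-∷-[] : ∀ b Y → δ (b ∷ Y) [] ≡ 0
δ-∷-[] b Y = δ-≢ λ ()

dropFinalOne : List ℕ → List (List ℕ)
dropFinalOne []          = []
dropFinalOne (x ∷ [])    = if x ≡ᵇ 1 then [ [] ] else []
dropFinalOne (x ∷ y ∷ L) = map (x ∷_) (dropFinalOne (y ∷ L))

decrements : List ℕ → List (ℕ × List ℕ)
decrements []      = []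
decrements (l ∷ L) = (l ∸ 1 , (l ∸ 1) ∷ L) ∷ map (map₂ (l ∷_)) (decrements L)

δ-++[1] : ∀ L′ L → δ (L′ ++ [ 1 ]) L ≡ ∑ (δ L′) (dropFinalOne L)
δ-++[1] []       []                  = δ-∷-[] 1 []
δ-++[1] []       (0 ∷ [])            = δ-≢ λ ()
δ-++[1] []       (1 ∷ [])            = trans (δ-refl [ 1 ]) (cong (_+ 0) (sym (δ-refl [])))
δ-++[1] []       (suc (suc _) ∷ [])  = δ-≢ λ ()
δ-++[1] []       (x ∷ y ∷ L)         = trans (δ-≢ λ ()) (sym (trans (∑-map (δ []) (x ∷_) (dropFinalOne (y ∷ L)))
                                         (∑-zero (δ-[]-∷ x) (dropFinalOne (y ∷ L)))))
δ-++[1] (a ∷ L′) []                  = δ-∷-[] a _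
δ-++[1] (a ∷ L′) (x ∷ [])            = trans (δ-≢ (++[1]≢[] L′ ∘ proj₂ ∘ ∷-injective)) (sym (none x))
  where
  ++[1]≢[] : ∀ L′ → L′ ++ [ 1 ] ≢ []
  ++[1]≢[] []      ()
  ++[1]≢[] (_ ∷ _) ()
  none : ∀ x → ∑ (δ (a ∷ L′)) (dropFinalOne (x ∷ [])) ≡ 0
  none 0             = refl
  none 1             = cong (_+ 0) (δ-∷-[] a L′)
  none (suc (suc _)) = refl
δ-++[1] (a ∷ L′) (x ∷ y ∷ L)         = begin
  δ (a ∷ L′ ++ [ 1 ]) (x ∷ y ∷ L)                          ≡⟨ δ-∷ a x (L′ ++ [ 1 ]) (y ∷ L) ⟩
  𝟙 (a ≟ x) * δ (L′ ++ [ 1 ]) (y ∷ L)                      ≡⟨ cong (𝟙 (a ≟ x) *_) (δ-++[1] L′ (y ∷ L)) ⟩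
  𝟙 (a ≟ x) * ∑ (δ L′) (dropFinalOne (y ∷ L))              ≡⟨ ∑-*ˡ (𝟙 (a ≟ x)) (δ L′) (dropFinalOne (y ∷ L)) ⟨
  ∑ (λ I → 𝟙 (a ≟ x) * δ L′ I) (dropFinalOne (y ∷ L))      ≡⟨ ∑-cong (δ-∷ a x L′) (dropFinalOne (y ∷ L)) ⟨
  ∑ (δ (a ∷ L′) ∘ (x ∷_)) (dropFinalOne (y ∷ L))           ≡⟨ ∑-map (δ (a ∷ L′)) (x ∷_) (dropFinalOne (y ∷ L)) ⟨
  ∑ (δ (a ∷ L′)) (dropFinalOne (x ∷ y ∷ L))                ∎

incrementSum-cong : ∀ {Φ Φ′ : List ℕ → ℕ} → (∀ X → Φ X ≡ Φ′ X) → ∀ L → incrementSum Φ L ≡ incrementSum Φ′ L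
incrementSum-cong Φ≗Φ′ []      = refl
incrementSum-cong Φ≗Φ′ (l ∷ L) = cong₂ _+_ (cong (l *_) (Φ≗Φ′ _)) (incrementSum-cong (Φ≗Φ′ ∘ (l ∷_)) L)

incrementSum-*ˡ : ∀ k (Φ : List ℕ → ℕ) L → incrementSum (λ X → k * Φ X) L ≡ k * incrementSum Φ L
incrementSum-*ˡ k Φ []      = sym (*-zeroʳ k)
incrementSum-*ˡ k Φ (l ∷ L) = begin
  l * (k * Φ (suc l ∷ L)) + incrementSum (λ X → k * Φ (l ∷ X)) L ≡⟨ cong (l * (k * Φ (suc l ∷ L)) +_) (incrementSum-*ˡ k (Φ ∘ (l ∷_)) L) ⟩
  l * (k * Φ (suc l ∷ L)) + k * incrementSum (Φ ∘ (l ∷_)) L      ≡⟨ x[ky]+kz≡k[xy+z] l k (Φ (suc l ∷ L)) _ ⟩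
  k * (l * Φ (suc l ∷ L) + incrementSum (Φ ∘ (l ∷_)) L)          ∎
  where x[ky]+kz≡k[xy+z] : ∀ x k y z → x * (k * y) + k * z ≡ k * (x * y + z)
        x[ky]+kz≡k[xy+z] = solve-∀

incrementSum-zero : ∀ {Φ : List ℕ → ℕ} → (∀ X → Φ X ≡ 0) → ∀ L → incrementSum Φ L ≡ 0
incrementSum-zero Φ≡0 []      = refl
incrementSum-zero Φ≡0 (l ∷ L) =
  cong₂ _+_ (trans (cong (l *_) (Φ≡0 _)) (*-zeroʳ l)) (incrementSum-zero (Φ≡0 ∘ (l ∷_)) L)

incrementSum-δ : ∀ L′ L → incrementSum (λ X → δ X L) L′ ≡ ∑ (λ (p , D) → p * δ L′ D) (decrements L)
incrementSum-δ []        []      = refl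
incrementSum-δ []        (l ∷ L) = sym (cong₂ _+_
  (trans (cong ((l ∸ 1) *_) (δ-[]-∷ (l ∸ 1) L)) (*-zeroʳ (l ∸ 1)))
  (trans (∑-map (λ (p , D) → p * δ [] D) (map₂ (l ∷_)) (decrements L))
         (∑-zero (λ (p , D) → trans (cong (p *_) (δ-[]-∷ l D)) (*-zeroʳ p)) (decrements L))))
incrementSum-δ (l′ ∷ R′) []      = cong₂ _+_ (trans (cong (l′ *_) (δ-∷-[] (suc l′) R′)) (*-zeroʳ l′))
                                             (incrementSum-zero (λ X → δ-∷-[] l′ X) R′)
incrementSum-δ (l′ ∷ R′) (l ∷ R) = cong₂ _+_ head≡ tail≡
  where
  -- growing l′ to l is the same as shrinking l to l′
  𝟙-suc : ∀ l′ l → l′ * 𝟙 (suc l′ ≟ l) ≡ (l ∸ 1) * 𝟙 (l′ ≟ (l ∸ 1))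
  𝟙-suc l′ zero    = trans (cong (l′ *_) (𝟙-no (suc l′ ≟ 0) λ ())) (*-zeroʳ l′)
  𝟙-suc l′ (suc k) = trans (cong (l′ *_) (𝟙-cong (suc l′ ≟ suc k) (l′ ≟ k) suc-injective (cong suc)))
                           (times-𝟙-≡ (l′ ≟ k))
    where times-𝟙-≡ : (l′≟k : Dec (l′ ≡ k)) → l′ * 𝟙 l′≟k ≡ k * 𝟙 l′≟k
          times-𝟙-≡ (yes refl) = refl
          times-𝟙-≡ (no l′≢k)  = trans (cong (l′ *_) (𝟙-no (no l′≢k) l′≢k))
                                  (trans (*-zeroʳ l′) (sym (trans (cong (k *_) (𝟙-no (no l′≢k) l′≢k)) (*-zeroʳ k))))
  head≡ : l′ * δ (suc l′ ∷ R′) (l ∷ R) ≡ (l ∸ 1) * δ (l′ ∷ R′) ((l ∸ 1) ∷ R)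
  head≡ = begin
    l′ * δ (suc l′ ∷ R′) (l ∷ R)                 ≡⟨ cong (l′ *_) (δ-∷ (suc l′) l R′ R) ⟩
    l′ * (𝟙 (suc l′ ≟ l) * δ R′ R)               ≡⟨ *-assoc l′ _ _ ⟨
    l′ * 𝟙 (suc l′ ≟ l) * δ R′ R                 ≡⟨ cong (_* δ R′ R) (𝟙-suc l′ l) ⟩
    (l ∸ 1) * 𝟙 (l′ ≟ (l ∸ 1)) * δ R′ R          ≡⟨ *-assoc (l ∸ 1) _ _ ⟩
    (l ∸ 1) * (𝟙 (l′ ≟ (l ∸ 1)) * δ R′ R)        ≡⟨ cong ((l ∸ 1) *_) (δ-∷ l′ (l ∸ 1) R′ R) ⟨
    (l ∸ 1) * δ (l′ ∷ R′) ((l ∸ 1) ∷ R)          ∎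
  k = 𝟙 (l′ ≟ l)
  tail≡ : incrementSum (λ X → δ (l′ ∷ X) (l ∷ R)) R′ ≡ ∑ (λ (p , D) → p * δ (l′ ∷ R′) D) (map (map₂ (l ∷_)) (decrements R))
  tail≡ = begin
    incrementSum (λ X → δ (l′ ∷ X) (l ∷ R)) R′          ≡⟨ incrementSum-cong (λ X → δ-∷ l′ l X R) R′ ⟩
    incrementSum (λ X → k * δ X R) R′                   ≡⟨ incrementSum-*ˡ k (λ X → δ X R) R′ ⟩
    k * incrementSum (λ X → δ X R) R′                   ≡⟨ cong (k *_) (incrementSum-δ R′ R) ⟩
    k * ∑ (λ (p , D) → p * δ R′ D) (decrements R)       ≡⟨ ∑-*ˡ k (λ (p , D) → p * δ R′ D) (decrements R) ⟨
    ∑ (λ (p , D) → k * (p * δ R′ D)) (decrements R)     ≡⟨ ∑-cong (λ (p , D) → trans (x[yz]≡y[xz] k p (δ R′ D)) (cong (p *_) (sym (δ-∷ l′ l R′ D)))) (decrements R) ⟩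
    ∑ (λ (p , D) → p * δ (l′ ∷ R′) (l ∷ D)) (decrements R)                  ≡⟨ ∑-map (λ (p , D) → p * δ (l′ ∷ R′) D) (map₂ (l ∷_)) (decrements R) ⟨
    ∑ (λ (p , D) → p * δ (l′ ∷ R′) D) (map (map₂ (l ∷_)) (decrements R))    ∎
    where x[yz]≡y[xz] : ∀ x y z → x * (y * z) ≡ y * (x * z)
          x[yz]≡y[xz] = solve-∀

-- typeCount m L counts the permutations of Fin m of ordered cycle structure L: the cycle of the
-- least remaining point is fixed by choosing, in order, l - 1 of the other m - 1 remaining points.
typeCount : ℕ → List ℕ → ℕ
typeCount zero    []          = 1
typeCount zero    (_ ∷ _)     = 0
typeCount (suc m) []          = 0
typeCount (suc m) (zero ∷ L)  = 0
typeCount (suc m) (suc l ∷ L) = (m P′ l) * typeCount (m ∸ l) L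

typeCount-0∷ : ∀ m L → typeCount m (0 ∷ L) ≡ 0
typeCount-0∷ zero    L = refl
typeCount-0∷ (suc m) L = refl

P′-suc : ∀ m k → suc m P′ suc k ≡ suc m * (m P′ k)
P′-suc m k = nP′k≡n[n∸1P′k∸1] (suc m) (suc k)

P′-vanishes : ∀ m k → m < k → m P′ k ≡ 0
P′-vanishes m (suc k) (s≤s m≤k) with m≤n⇒m<n∨m≡n m≤k
... | inj₁ m<k  = trans (cong ((m ∸ k) *_) (P′-vanishes m k m<k)) (*-zeroʳ (m ∸ k))
... | inj₂ refl = cong (_* (m P′ m)) (n∸n≡0 m)

-- the permutations of Fin m, with multiplicity, that become of type L when m is inserted
shrinkSum : ℕ → List ℕ → ℕ
shrinkSum m L = ∑ (typeCount m) (dropFinalOne L) + ∑ (λ (p , D) → p * typeCount m D) (decrements L)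

-- the part of shrinkSum m (l ∷ R) that keeps the first cycle length l
headSum : ℕ → ℕ → List ℕ → ℕ
headSum m l R = ∑ (typeCount m) (dropFinalOne (l ∷ R)) + ∑ (λ (p , D) → p * typeCount m (l ∷ D)) (decrements R)

shrinkSum-∷ : ∀ m l R → shrinkSum m (l ∷ R) ≡ (l ∸ 1) * typeCount m ((l ∸ 1) ∷ R) + headSum m l R
shrinkSum-∷ m l R = begin
  I + (d + ∑ (λ (p , D) → p * typeCount m D) (map (map₂ (l ∷_)) (decrements R)))
    ≡⟨ cong (λ t → I + (d + t)) (∑-map (λ (p , D) → p * typeCount m D) (map₂ (l ∷_)) (decrements R)) ⟩
  I + (d + K)  ≡⟨ x+[y+z]≡y+[x+z] I d K ⟩
  d + (I + K)  ∎
  where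
  I = ∑ (typeCount m) (dropFinalOne (l ∷ R))
  d = (l ∸ 1) * typeCount m ((l ∸ 1) ∷ R)
  K = ∑ (λ (p , D) → p * typeCount m (l ∷ D)) (decrements R)
  x+[y+z]≡y+[x+z] : ∀ x y z → x + (y + z) ≡ y + (x + z)
  x+[y+z]≡y+[x+z] = solve-∀

headSum-vanishes : ∀ m l y R → (∀ X → typeCount m (l ∷ X) ≡ 0) → headSum m l (y ∷ R) ≡ 0
headSum-vanishes m l y R tc≡0 = cong₂ _+_
  (trans (∑-map (typeCount m) (l ∷_) (dropFinalOne (y ∷ R))) (∑-zero tc≡0 (dropFinalOne (y ∷ R))))
  (∑-zero (λ (p , D) → trans (cong (p *_) (tc≡0 D)) (*-zeroʳ p)) (decrements (y ∷ R)))

-- the first cycle of a permutation of Fin (2 + m) either avoids the top point, or contains it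
first-cycle : ∀ m l R → l * typeCount (suc m) (l ∷ R) + (m P′ l) * typeCount (suc (m ∸ l)) R
                      ≡ typeCount (suc (suc m)) (suc l ∷ R)
first-cycle m zero    R = refl
first-cycle m (suc k) R with <-cmp k m
... | tri< k<m _ _ = begin
  suc k * (a * w) + (m ∸ k) * a * typeCount (suc (m ∸ suc k)) R ≡⟨ cong (λ t → suc k * (a * w) + (m ∸ k) * a * typeCount t R) (+-∸-assoc 1 k<m) ⟨
  suc k * (a * w) + (m ∸ k) * a * w                             ≡⟨ distrib k (m ∸ k) a w ⟩
  suc (k + (m ∸ k)) * a * w                                     ≡⟨ cong (λ t → suc t * a * w) (m+[n∸m]≡n (<⇒≤ k<m)) ⟩
  suc m * a * w                                                 ≡⟨ cong (_* w) (P′-suc m k) ⟨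
  (suc m P′ suc k) * w                                            ∎
  where
  a = m P′ k
  w = typeCount (m ∸ k) R
  distrib : ∀ k d a w → suc k * (a * w) + d * a * w ≡ suc (k + d) * a * w
  distrib = solve-∀
... | tri≈ _ refl _ = begin
  suc k * (a * w) + (k ∸ k) * a * typeCount (suc (k ∸ suc k)) R ≡⟨ cong (λ t → suc k * (a * w) + t * a * typeCount (suc (k ∸ suc k)) R) (n∸n≡0 k) ⟩
  suc k * (a * w) + 0                                           ≡⟨ +-identityʳ _ ⟩
  suc k * (a * w)                                               ≡⟨ *-assoc (suc k) a w ⟨
  suc k * a * w                                                 ≡⟨ cong (_* w) (P′-suc k k) ⟨
  (suc k P′ suc k) * w                                            ∎
  where
  a = k P′ k
  w = typeCount (k ∸ k) R
... | tri> _ _ m<k = begin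
  suc k * ((m P′ k) * w) + (m ∸ k) * (m P′ k) * typeCount (suc (m ∸ suc k)) R ≡⟨ cong (λ t → suc k * (t * w) + (m ∸ k) * t * typeCount (suc (m ∸ suc k)) R) a≡0 ⟩
  suc k * 0 + (m ∸ k) * 0 * typeCount (suc (m ∸ suc k)) R                 ≡⟨ cong₂ _+_ (*-zeroʳ (suc k)) (cong (_* typeCount (suc (m ∸ suc k)) R) (*-zeroʳ (m ∸ k))) ⟩
  0                                                                        ≡⟨ cong (_* w) (trans (P′-suc m k) (trans (cong (suc m *_) a≡0) (*-zeroʳ (suc m)))) ⟨
  (suc m P′ suc k) * w                                                       ∎
  where
  a≡0 = P′-vanishes m k m<k
  w = typeCount (m ∸ k) R

mutual
  typeCount-suc : ∀ m L → typeCount (suc m) L ≡ shrinkSum m L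
  typeCount-suc m []      = refl
  typeCount-suc m (l ∷ R) = sym (trans (shrinkSum-∷ m l R) (typeCount-suc-∷ m l R))

  typeCount-suc-∷ : ∀ m l R → (l ∸ 1) * typeCount m ((l ∸ 1) ∷ R) + headSum m l R ≡ typeCount (suc m) (l ∷ R)
  typeCount-suc-∷ m       0 []      = refl
  typeCount-suc-∷ m       0 (y ∷ R) = headSum-vanishes m 0 y R (typeCount-0∷ m)
  typeCount-suc-∷ zero    1 []      = refl
  typeCount-suc-∷ zero    1 (y ∷ R) = trans (headSum-vanishes 0 1 y R λ _ → refl) (sym (+-identityʳ (typeCount 0 (y ∷ R))))
  typeCount-suc-∷ zero    (suc (suc k)) R = trans (cong (_+ headSum 0 (suc (suc k)) R) (*-zeroʳ (suc k))) (trans (vanishes R)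
    (sym (cong (λ t → t * (0 P′ k) * typeCount 0 R) (0∸n≡0 k))))
    where
    vanishes : ∀ R → headSum 0 (suc (suc k)) R ≡ 0
    vanishes []      = refl
    vanishes (y ∷ R) = headSum-vanishes 0 (suc (suc k)) y R λ _ → refl
  typeCount-suc-∷ (suc m) (suc l) R = begin
    l * typeCount (suc m) (l ∷ R) + headSum (suc m) (suc l) R ≡⟨ cong (l * typeCount (suc m) (l ∷ R) +_) (headSum-factor m l R) ⟩
    l * typeCount (suc m) (l ∷ R) + (m P′ l) * typeCount (suc (m ∸ l)) R ≡⟨ first-cycle m l R ⟩
    typeCount (suc (suc m)) (suc l ∷ R) ∎

  headSum-factor : ∀ m l R → headSum (suc m) (suc l) R ≡ (m P′ l) * typeCount (suc (m ∸ l)) R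
  headSum-factor m 0       []      = refl
  headSum-factor m (suc l) []      = sym (*-zeroʳ (m P′ suc l))
  headSum-factor m l       (y ∷ R) = begin
    headSum (suc m) (suc l) (y ∷ R)
      ≡⟨ cong₂ _+_ (trans (∑-map (typeCount (suc m)) (suc l ∷_) (dropFinalOne (y ∷ R)))
                          (∑-*ˡ (m P′ l) (typeCount (m ∸ l)) (dropFinalOne (y ∷ R))))
                   (trans (∑-cong (λ (p , D) → x[ky]≡k[xy] p (m P′ l) (typeCount (m ∸ l) D)) (decrements (y ∷ R)))
                          (∑-*ˡ (m P′ l) (λ (p , D) → p * typeCount (m ∸ l) D) (decrements (y ∷ R)))) ⟩
    (m P′ l) * ∑ (typeCount (m ∸ l)) (dropFinalOne (y ∷ R)) + (m P′ l) * ∑ (λ (p , D) → p * typeCount (m ∸ l) D) (decrements (y ∷ R))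
      ≡⟨ *-distribˡ-+ (m P′ l) _ _ ⟨
    (m P′ l) * shrinkSum (m ∸ l) (y ∷ R)
      ≡⟨ cong ((m P′ l) *_) (typeCount-suc (m ∸ l) (y ∷ R)) ⟨
    (m P′ l) * typeCount (suc (m ∸ l)) (y ∷ R)
      ∎
    where x[ky]≡k[xy] : ∀ x k y → x * (k * y) ≡ k * (x * y)
          x[ky]≡k[xy] = solve-∀

insertionSum-δ : ∀ L X → insertionSum (λ Y → δ Y L) X ≡ ∑ (δ X) (dropFinalOne L) + ∑ (λ (p , D) → p * δ X D) (decrements L)
insertionSum-δ L X = cong₂ _+_ (δ-++[1] X L) (incrementSum-δ X L)

count-cycleType : ∀ m L → ∑ (λ τ → δ (cycleType τ) L) (perms m) ≡ typeCount m L
count-cycleType zero    []      = cong (_+ 0) (δ-refl [])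
count-cycleType zero    (y ∷ L) = cong (_+ 0) (δ-[]-∷ y L)
count-cycleType (suc m) L = begin
  ∑ (λ τ → δ (cycleType τ) L) (perms (suc m))
    ≡⟨ ∑-perms-suc-cycleType m (λ Y → δ Y L) ⟩
  ∑ (λ τ → insertionSum (λ Y → δ Y L) (cycleType τ)) (perms m)
    ≡⟨ ∑-cong (insertionSum-δ L ∘ cycleType) (perms m) ⟩
  ∑ (λ τ → ∑ (δ (cycleType τ)) (dropFinalOne L) + ∑ (λ (p , D) → p * δ (cycleType τ) D) (decrements L)) (perms m)
    ≡⟨ ∑-+ _ _ (perms m) ⟩
  ∑ (λ τ → ∑ (δ (cycleType τ)) (dropFinalOne L)) (perms m) + ∑ (λ τ → ∑ (λ (p , D) → p * δ (cycleType τ) D) (decrements L)) (perms m)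
    ≡⟨ cong₂ _+_ (∑-comm (δ ∘ cycleType) (perms m) (dropFinalOne L))
                 (trans (∑-comm (λ τ (p , D) → p * δ (cycleType τ) D) (perms m) (decrements L))
                        (∑-cong (λ (p , D) → ∑-*ˡ p (λ τ → δ (cycleType τ) D) (perms m)) (decrements L))) ⟩
  ∑ (λ I → ∑ (λ τ → δ (cycleType τ) I) (perms m)) (dropFinalOne L) + ∑ (λ (p , D) → p * ∑ (λ τ → δ (cycleType τ) D) (perms m)) (decrements L)
    ≡⟨ cong₂ _+_ (∑-cong (count-cycleType m) (dropFinalOne L))
                 (∑-cong (λ (p , D) → cong (p *_) (count-cycleType m D)) (decrements L)) ⟩
  shrinkSum m L
    ≡⟨ typeCount-suc m L ⟨
  typeCount (suc m) L
    ∎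

IsComposition : ℕ → List ℕ → Set
IsComposition m L = All (0 <_) L × sum L ≡ m

typeCount≢0⇒IsComposition : ∀ m L → typeCount m L ≢ 0 → IsComposition m L
typeCount≢0⇒IsComposition zero    []          _   = [] , refl
typeCount≢0⇒IsComposition zero    (_ ∷ _)     tc≢0 = contradiction refl tc≢0
typeCount≢0⇒IsComposition (suc m) []          tc≢0 = contradiction refl tc≢0
typeCount≢0⇒IsComposition (suc m) (zero ∷ L)  tc≢0 = contradiction refl tc≢0
typeCount≢0⇒IsComposition (suc m) (suc l ∷ L) tc≢0 =
  let L-pos , sum≡ = typeCount≢0⇒IsComposition (m ∸ l) L (tc≢0 ∘ zero-right) in
  s≤s z≤n ∷ L-pos , cong suc (trans (cong (l +_) sum≡) (m+[n∸m]≡n l≤m))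
  where
  zero-right : typeCount (m ∸ l) L ≡ 0 → (m P′ l) * typeCount (m ∸ l) L ≡ 0
  zero-right tc≡0 = trans (cong ((m P′ l) *_) tc≡0) (*-zeroʳ (m P′ l))
  l≤m : l ≤ m
  l≤m = ≮⇒≥ λ m<l → tc≢0 (cong (_* typeCount (m ∸ l) L) (P′-vanishes m l m<l))

cycleType-IsComposition : ∀ {n} {σ : Vec (Fin n) n} → σ ∈ perms n → IsComposition n (cycleType σ)
cycleType-IsComposition {n} {σ} σ∈ = typeCount≢0⇒IsComposition n (cycleType σ) λ tc≡0 →
  1+n≢0 (trans (sym (δ-refl (cycleType σ))) (∑≡0⇒ (perms n) (trans (count-cycleType n (cycleType σ)) tc≡0) σ∈))

-- Compositions and the Jacobi-Stirling recurrence

compositions : ℕ → ℕ → List (List ℕ)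
compositions n       (suc k) = concatMap (λ l → map (suc l ∷_) (compositions (n ∸ suc l) k)) (upTo n)
compositions zero    zero    = [ [] ]
compositions (suc n) zero    = []

∑-δ-compositions : ∀ n k L → IsComposition n L → ∑ (δ L) (compositions n k) ≡ 𝟙 (length L ≟ k)
∑-δ-compositions zero    zero    []      _              = trans (cong (_+ 0) (δ-refl [])) (sym (𝟙-yes (0 ≟ 0) refl))
∑-δ-compositions zero    zero    (x ∷ L) _              = trans (cong (_+ 0) (δ-∷-[] x L)) (sym (𝟙-no (suc (length L) ≟ 0) λ ()))
∑-δ-compositions (suc n) zero    (x ∷ L) _              = sym (𝟙-no (suc (length L) ≟ 0) λ ())
∑-δ-compositions n       (suc k) []      _              = trans
  (∑-concatMap (δ []) (λ l → map (suc l ∷_) (compositions (n ∸ suc l) k)) (upTo n))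
  (trans (∑-zero (λ l → trans (∑-map (δ []) (suc l ∷_) (compositions (n ∸ suc l) k))
                                (∑-zero (δ-[]-∷ (suc l)) (compositions (n ∸ suc l) k))) (upTo n))
         (sym (𝟙-no (0 ≟ suc k) λ ())))
∑-δ-compositions n       (suc k) (suc x ∷ R) (_ ∷ R-pos , sum≡n) = begin
  ∑ (δ (suc x ∷ R)) (compositions n (suc k))
    ≡⟨ ∑-concatMap (δ (suc x ∷ R)) (λ l → map (suc l ∷_) (compositions (n ∸ suc l) k)) (upTo n) ⟩
  ∑ (λ l → ∑ (δ (suc x ∷ R)) (map (suc l ∷_) (compositions (n ∸ suc l) k))) (upTo n)
    ≡⟨ ∑-cong first-part (upTo n) ⟩
  ∑ (λ l → 𝟙 (l ≟ x) * ∑ (δ R) (compositions (n ∸ suc l) k)) (upTo n)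
    ≡⟨ ∑-𝟙-≡ _≟_ (λ l → ∑ (δ R) (compositions (n ∸ suc l) k)) (upTo n) (upTo⁺ n) (∈-upTo⁺ x<n) ⟩
  ∑ (δ R) (compositions (n ∸ suc x) k)
    ≡⟨ ∑-δ-compositions (n ∸ suc x) k R (R-pos , sum-R) ⟩
  𝟙 (length R ≟ k)
    ≡⟨ 𝟙-cong (length R ≟ k) (suc (length R) ≟ suc k) (cong suc) suc-injective ⟩
  𝟙 (suc (length R) ≟ suc k)
    ∎
  where
  x<n : x < n
  x<n = subst (x <_) sum≡n (s≤s (m≤m+n x (sum R)))
  sum-R : sum R ≡ n ∸ suc x
  sum-R = sym (trans (cong (_∸ suc x) (sym sum≡n)) (m+n∸m≡n (suc x) (sum R)))
  first-part : ∀ l → ∑ (δ (suc x ∷ R)) (map (suc l ∷_) (compositions (n ∸ suc l) k))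
                   ≡ 𝟙 (l ≟ x) * ∑ (δ R) (compositions (n ∸ suc l) k)
  first-part l = begin
    ∑ (δ (suc x ∷ R)) (map (suc l ∷_) Cs)  ≡⟨ ∑-map (δ (suc x ∷ R)) (suc l ∷_) Cs ⟩
    ∑ (λ D → δ (suc x ∷ R) (suc l ∷ D)) Cs ≡⟨ ∑-cong (λ D → trans (δ-∷ (suc x) (suc l) R D) (cong (_* δ R D) 𝟙-suc)) Cs ⟩
    ∑ (λ D → 𝟙 (l ≟ x) * δ R D) Cs         ≡⟨ ∑-*ˡ (𝟙 (l ≟ x)) (δ R) Cs ⟩
    𝟙 (l ≟ x) * ∑ (δ R) Cs                 ∎
    where
    Cs = compositions (n ∸ suc l) k
    𝟙-suc : 𝟙 (suc x ≟ suc l) ≡ 𝟙 (l ≟ x)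
    𝟙-suc = 𝟙-cong (suc x ≟ suc l) (l ≟ x) (sym ∘ suc-injective) (cong suc ∘ sym)

esym-∷ʳ : ∀ m ys x → esym (suc m) (ys ++ [ x ]) ≡ x * esym m ys + esym (suc m) ys
esym-∷ʳ m       []       x = refl
esym-∷ʳ zero    (y ∷ ys) x rewrite esym-∷ʳ zero ys x = rearrange y x (esym 1 ys)
  where rearrange : ∀ y x e → y * 1 + (x * 1 + e) ≡ x * 1 + (y * 1 + e)
        rearrange = solve-∀
esym-∷ʳ (suc m) (y ∷ ys) x rewrite esym-∷ʳ m ys x | esym-∷ʳ (suc m) ys x =
  rearrange y x (esym m ys) (esym (suc m) ys) (esym (suc (suc m)) ys)
  where rearrange : ∀ y x a b c → y * (x * a + b) + (x * b + c) ≡ x * (y * a + b) + (y * b + c)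
        rearrange = solve-∀

esym-vanishes : ∀ m ys → length ys < m → esym m ys ≡ 0
esym-vanishes (suc m) []       _         = refl
esym-vanishes (suc m) (y ∷ ys) (s≤s |ys|<m) = begin
  y * esym m ys + esym (suc m) ys ≡⟨ cong₂ (λ a b → y * a + b) (esym-vanishes m ys |ys|<m)
                                            (esym-vanishes (suc m) ys (m<n⇒m<1+n |ys|<m)) ⟩
  y * 0 + 0                       ≡⟨ trans (+-identityʳ _) (*-zeroʳ y) ⟩
  0                               ∎

module _ (z : ℕ) where

  x : ℕ → ℕ
  x n = n * (n + z)

  jsVars-suc : ∀ n → jsVars (suc (suc n)) z ≡ jsVars (suc n) z ++ [ x (suc n) ]
  jsVars-suc n = trans (cong (map _) (sym (upTo-∷ʳ n))) (map-++ _ (upTo n) [ n ])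

  Jc-≤ : ∀ n k → k ≤ n → Jc n k z ≡ esym (n ∸ k) (jsVars n z)
  Jc-≤ n k k≤n with k ≤? n
  ... | yes _   = refl
  ... | no  k≰n = contradiction k≤n k≰n

  Jc-> : ∀ n k → n < k → Jc n k z ≡ 0
  Jc-> n k n<k with k ≤? n
  ... | yes k≤n = contradiction n<k (≤⇒≯ k≤n)
  ... | no  _   = refl

  Jc-suc-zero : ∀ n → Jc (suc n) 0 z ≡ 0
  Jc-suc-zero n = trans (Jc-≤ (suc n) 0 z≤n) (esym-vanishes (suc n) (jsVars (suc n) z)
    (s≤s (≤-reflexive (trans (length-map _ (upTo n)) (length-upTo n)))))

  Jc-diagonal : ∀ n → Jc n n z ≡ 1
  Jc-diagonal n = trans (Jc-≤ n n ≤-refl) (cong (λ t → esym t (jsVars n z)) (n∸n≡0 n))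

  Jc-suc : ∀ n k → Jc (suc n) (suc k) z ≡ Jc n k z + x n * Jc n (suc k) z
  Jc-suc n k with <-cmp k n
  ... | tri> _ _ n<k  = begin
    Jc (suc n) (suc k) z               ≡⟨ Jc-> (suc n) (suc k) (s≤s n<k) ⟩
    0                                  ≡⟨ *-zeroʳ (x n) ⟨
    0 + x n * 0                        ≡⟨ cong₂ (λ a b → a + x n * b) (Jc-> n k n<k) (Jc-> n (suc k) (m<n⇒m<1+n n<k)) ⟨
    Jc n k z + x n * Jc n (suc k) z    ∎
  ... | tri≈ _ refl _ = begin
    Jc (suc n) (suc n) z               ≡⟨ Jc-diagonal (suc n) ⟩
    1                                  ≡⟨ cong (1 +_) (*-zeroʳ (x n)) ⟨
    1 + x n * 0                        ≡⟨ cong₂ (λ a b → a + x n * b) (Jc-diagonal n) (Jc-> n (suc n) (n<1+n n)) ⟨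
    Jc n n z + x n * Jc n (suc n) z    ∎
  Jc-suc (suc n) k | tri< k<1+n _ _ = begin
    Jc (suc (suc n)) (suc k) z                                      ≡⟨ Jc-≤ (suc (suc n)) (suc k) (s≤s (<⇒≤ k<1+n)) ⟩
    esym (suc n ∸ k) (jsVars (suc (suc n)) z)                       ≡⟨ cong₂ esym d+1≡ (jsVars-suc n) ⟩
    esym (suc d) (jsVars (suc n) z ++ [ x (suc n) ])                ≡⟨ esym-∷ʳ d (jsVars (suc n) z) (x (suc n)) ⟩
    x (suc n) * esym d (jsVars (suc n) z) + esym (suc d) (jsVars (suc n) z) ≡⟨ +-comm (x (suc n) * esym d (jsVars (suc n) z)) _ ⟩
    esym (suc d) (jsVars (suc n) z) + x (suc n) * esym d (jsVars (suc n) z)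
      ≡⟨ cong₂ (λ a b → a + x (suc n) * b) (trans (Jc-≤ (suc n) k (<⇒≤ k<1+n)) (cong (λ t → esym t (jsVars (suc n) z)) d+1≡)) (Jc-≤ (suc n) (suc k) k<1+n) ⟨
    Jc (suc n) k z + x (suc n) * Jc (suc n) (suc k) z               ∎
    where
    d = suc n ∸ suc k
    d+1≡ : suc n ∸ k ≡ suc d
    d+1≡ = +-∸-assoc 1 k<1+n

  pairCount : ℕ → ℕ → ℕ
  pairCount n k = ∑ (λ D → typeCount n D * typeCount (n + z) (D ++ replicate z 1)) (compositions n k)

  typeCount-ones : ∀ m → typeCount m (replicate m 1) ≡ 1
  typeCount-ones zero    = refl
  typeCount-ones (suc m) = trans (+-identityʳ _) (typeCount-ones m)

  pairCount-suc : ∀ n k → pairCount (suc n) (suc k) ≡ ∑ (λ l → (n P′ l) * ((n + z) P′ l) * pairCount (n ∸ l) k) (upTo (suc n))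
  pairCount-suc n k = trans (∑-concatMap pair (λ l → map (suc l ∷_) (compositions (n ∸ l) k)) (upTo (suc n)))
                            (∑-upTo-cong (suc n) first-part)
    where
    pair : List ℕ → ℕ
    pair D = typeCount (suc n) D * typeCount (suc n + z) (D ++ replicate z 1)
    first-part : ∀ l → l < suc n → ∑ pair (map (suc l ∷_) (compositions (n ∸ l) k))
                                  ≡ (n P′ l) * ((n + z) P′ l) * pairCount (n ∸ l) k
    first-part l (s≤s l≤n) = begin
      ∑ pair (map (suc l ∷_) Cs)  ≡⟨ ∑-map pair (suc l ∷_) Cs ⟩
      ∑ (λ D → ((n P′ l) * typeCount (n ∸ l) D) * (((n + z) P′ l) * typeCount (n + z ∸ l) (D ++ replicate z 1))) Cs
        ≡⟨ ∑-cong (λ D → trans (cong (λ t → ((n P′ l) * typeCount (n ∸ l) D) * (((n + z) P′ l) * typeCount t (D ++ replicate z 1))) (+-∸-comm z l≤n))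
                               (interchange (n P′ l) ((n + z) P′ l) (typeCount (n ∸ l) D) _)) Cs ⟩
      ∑ (λ D → (n P′ l) * ((n + z) P′ l) * (typeCount (n ∸ l) D * typeCount (n ∸ l + z) (D ++ replicate z 1))) Cs
        ≡⟨ ∑-*ˡ ((n P′ l) * ((n + z) P′ l)) (λ D → typeCount (n ∸ l) D * typeCount (n ∸ l + z) (D ++ replicate z 1)) Cs ⟩
      (n P′ l) * ((n + z) P′ l) * pairCount (n ∸ l) k ∎
      where
      Cs = compositions (n ∸ l) k
      interchange : ∀ a b c d → (a * c) * (b * d) ≡ (a * b) * (c * d)
      interchange = solve-∀

  pairCount-rec : ∀ n k → pairCount (suc n) (suc k) ≡ pairCount n k + x n * pairCount n (suc k)
  pairCount-rec zero    k = trans (pairCount-suc zero k) (trans (+-identityʳ _) (trans (+-identityʳ _) (sym (+-identityʳ _))))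
  pairCount-rec (suc n) k = begin
    pairCount (suc (suc n)) (suc k)
      ≡⟨ pairCount-suc (suc n) k ⟩
    ∑ (λ l → weight (suc n) l * pairCount (suc n ∸ l) k) (upTo (suc (suc n)))
      ≡⟨ ∑-upTo-suc (λ l → weight (suc n) l * pairCount (suc n ∸ l) k) (suc n) ⟩
    1 * 1 * pairCount (suc n) k + ∑ (λ l → weight (suc n) (suc l) * pairCount (n ∸ l) k) (upTo (suc n))
      ≡⟨ cong₂ _+_ (+-identityʳ (pairCount (suc n) k)) (∑-cong (λ l → trans (cong (_* pairCount (n ∸ l) k) (weight-suc l)) (*-assoc (x (suc n)) (weight n l) _)) (upTo (suc n))) ⟩
    pairCount (suc n) k + ∑ (λ l → x (suc n) * (weight n l * pairCount (n ∸ l) k)) (upTo (suc n))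
      ≡⟨ cong (pairCount (suc n) k +_) (trans (∑-*ˡ (x (suc n)) (λ l → weight n l * pairCount (n ∸ l) k) (upTo (suc n)))
                                              (cong (x (suc n) *_) (sym (pairCount-suc n k)))) ⟩
    pairCount (suc n) k + x (suc n) * pairCount (suc n) (suc k)
      ∎
    where
    weight : ℕ → ℕ → ℕ
    weight n l = (n P′ l) * ((n + z) P′ l)
    weight-suc : ∀ l → weight (suc n) (suc l) ≡ x (suc n) * weight n l
    weight-suc l = trans (cong₂ _*_ (P′-suc n l) (P′-suc (n + z) l)) (regroup (suc n) z (n P′ l) ((n + z) P′ l))
      where regroup : ∀ p q a b → (p * a) * ((p + q) * b) ≡ p * (p + q) * (a * b)
            regroup = solve-∀

  pairCount≡Jc : ∀ n k → pairCount n k ≡ Jc n k z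
  pairCount≡Jc zero    zero    = trans (+-identityʳ _) (trans (+-identityʳ _) (typeCount-ones z))
  pairCount≡Jc zero    (suc k) = refl
  pairCount≡Jc (suc n) zero    = sym (Jc-suc-zero n)
  pairCount≡Jc (suc n) (suc k) = begin
    pairCount (suc n) (suc k)                  ≡⟨ pairCount-rec n k ⟩
    pairCount n k + x n * pairCount n (suc k)  ≡⟨ cong₂ (λ a b → a + x n * b) (pairCount≡Jc n k) (pairCount≡Jc n (suc k)) ⟩
    Jc n k z + x n * Jc n (suc k) z            ≡⟨ Jc-suc n k ⟨
    Jc (suc n) (suc k) z                       ∎

All-≡⇒replicate : ∀ {a : A} xs → All (_≡ a) xs → xs ≡ replicate (length xs) a
All-≡⇒replicate []       []           = refl
All-≡⇒replicate (x ∷ xs) (refl ∷ xs≡) = cong (x ∷_) (All-≡⇒replicate xs xs≡)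

take-length-++ : ∀ (xs ys : List A) → take (length xs) (xs ++ ys) ≡ xs
take-length-++ []       ys = refl
take-length-++ (x ∷ xs) ys = cong (x ∷_) (take-length-++ xs ys)

drop-length-++ : ∀ (xs ys : List A) → drop (length xs) (xs ++ ys) ≡ ys
drop-length-++ []       ys = refl
drop-length-++ (x ∷ xs) ys = drop-length-++ xs ys

SameUpTo⇒≡++ones : ∀ k z (c d : List ℕ) → SameUpTo k c d → length c ≡ k → length d ≡ k + z → d ≡ c ++ replicate z 1
SameUpTo⇒≡++ones k z c d (take≡ , _ , drop-d≡1) refl |d|≡ = begin
  d                                     ≡⟨ take++drop≡id k d ⟨
  take k d ++ drop k d                  ≡⟨ cong₂ _++_ (trans (sym take≡) (take-all k c ≤-refl)) (All-≡⇒replicate (drop k d) drop-d≡1) ⟩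
  c ++ replicate (length (drop k d)) 1  ≡⟨ cong (λ t → c ++ replicate t 1) (trans (length-drop k d) (trans (cong (_∸ k) |d|≡) (m+n∸m≡n k z))) ⟩
  c ++ replicate z 1                    ∎

≡++ones⇒SameUpTo : ∀ z (c : List ℕ) → SameUpTo (length c) c (c ++ replicate z 1) × length (c ++ replicate z 1) ≡ length c + z
≡++ones⇒SameUpTo z c =
  (trans (take-all (length c) c ≤-refl) (sym (take-length-++ c (replicate z 1))) ,
   subst (All (_≡ 1)) (sym (drop-all (length c) c ≤-refl)) [] ,
   subst (All (_≡ 1)) (sym (drop-length-++ c (replicate z 1))) (replicate⁺ z refl)) ,
  trans (length-++ c) (cong (length c +_) (length-replicate z))

𝟙-goodPair : ∀ {n z} k (σ : Vec (Fin n) n) (τ : Vec (Fin (n + z)) (n + z)) →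
  𝟙 (goodPair? {n} {z} k (σ , τ)) ≡ 𝟙 (numCycles σ ≟ k) * δ (cycleType τ) (cycleType σ ++ replicate z 1)
𝟙-goodPair {n} {z} k σ τ = trans (𝟙-cong (goodPair? {n} {z} k (σ , τ)) ((numCycles σ ≟ k) ×-dec (d ≟ₗ (c ++ replicate z 1))) to from)
                                 (𝟙-× (numCycles σ ≟ k) (d ≟ₗ (c ++ replicate z 1)))
  where
  c = cycleType σ
  d = cycleType τ
  to : GoodPair {n} {z} k (σ , τ) → numCycles σ ≡ k × d ≡ c ++ replicate z 1
  to (same , |c|≡k , |d|≡) = |c|≡k , SameUpTo⇒≡++ones k z c d same |c|≡k |d|≡
  from : numCycles σ ≡ k × d ≡ c ++ replicate z 1 → GoodPair {n} {z} k (σ , τ)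
  from (refl , d≡) rewrite d≡ = let same , |d|≡ = ≡++ones⇒SameUpTo z c in same , refl , |d|≡

δ-subst : ∀ (g : List ℕ → ℕ) L D → δ L D * g D ≡ δ L D * g L
δ-subst g L D with L ≟ₗ D
... | yes refl = refl
... | no  L≢D  = trans (cong (_* g D) (𝟙-no (no L≢D) L≢D)) (sym (cong (_* g L) (𝟙-no (no L≢D) L≢D)))

countPairs≡pairCount : ∀ n k z → countPairs n k z ≡ pairCount z n k
countPairs≡pairCount n k z = begin
  countPairs n k z
    ≡⟨ length-filter≡∑𝟙 (goodPair? k) (cartesianProduct (perms n) (perms (n + z))) ⟩
  ∑ (λ p → 𝟙 (goodPair? {n} {z} k p)) (cartesianProduct (perms n) (perms (n + z)))
    ≡⟨ ∑-cartesianProductWith (λ p → 𝟙 (goodPair? {n} {z} k p)) _,_ (perms n) (perms (n + z)) ⟩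
  ∑ (λ σ → ∑ (λ τ → 𝟙 (goodPair? {n} {z} k (σ , τ))) (perms (n + z))) (perms n)
    ≡⟨ ∑-cong (λ σ → trans (∑-cong (𝟙-goodPair {n} {z} k σ) (perms (n + z)))
                     (trans (∑-*ˡ (𝟙 (numCycles σ ≟ k)) (λ τ → δ (cycleType τ) (cycleType σ ++ replicate z 1)) (perms (n + z)))
                            (cong (𝟙 (numCycles σ ≟ k) *_) (count-cycleType (n + z) (cycleType σ ++ replicate z 1))))) (perms n) ⟩
  ∑ (λ σ → 𝟙 (numCycles σ ≟ k) * g (cycleType σ)) (perms n)
    ≡⟨ ∑-cong-∈ (perms n) split-by-type ⟩
  ∑ (λ σ → ∑ (λ D → δ (cycleType σ) D * g D) (compositions n k)) (perms n)
    ≡⟨ ∑-comm (λ σ D → δ (cycleType σ) D * g D) (perms n) (compositions n k) ⟩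
  ∑ (λ D → ∑ (λ σ → δ (cycleType σ) D * g D) (perms n)) (compositions n k)
    ≡⟨ ∑-cong (λ D → trans (∑-*ʳ (g D) (λ σ → δ (cycleType σ) D) (perms n)) (cong (_* g D) (count-cycleType n D))) (compositions n k) ⟩
  pairCount z n k
    ∎
  where
  g : List ℕ → ℕ
  g D = typeCount (n + z) (D ++ replicate z 1)
  split-by-type : ∀ {σ} → σ ∈ perms n → 𝟙 (numCycles σ ≟ k) * g (cycleType σ) ≡ ∑ (λ D → δ (cycleType σ) D * g D) (compositions n k)
  split-by-type {σ} σ∈ = sym (begin
    ∑ (λ D → δ (cycleType σ) D * g D) (compositions n k)           ≡⟨ ∑-cong (δ-subst g (cycleType σ)) (compositions n k) ⟩
    ∑ (λ D → δ (cycleType σ) D * g (cycleType σ)) (compositions n k) ≡⟨ ∑-*ʳ (g (cycleType σ)) (δ (cycleType σ)) (compositions n k) ⟩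
    ∑ (δ (cycleType σ)) (compositions n k) * g (cycleType σ)        ≡⟨ cong (_* g (cycleType σ)) (∑-δ-compositions n k (cycleType σ) (cycleType-IsComposition σ∈)) ⟩
    𝟙 (numCycles σ ≟ k) * g (cycleType σ)                           ∎)

corollaryC : (n k z : ℕ) → Jc n k z ≡ countPairs n k z
corollaryC n k z = sym (trans (countPairs≡pairCount n k z) (pairCount≡Jc z n k))
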